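{- Let $\ell\ge4$ be an integer, $a_0\in\mathbb{Z}$, let $\{a_n\}_{n=1}^\infty$ be a sequence of positive integers and $\alpha=[a_0;a_1,a_2,a_3,\ldots]$, and let $\varphi=\frac{1+\sqrt5}{2}$. (i) If $\limsup_{n\to\infty}\frac{\log a_{2n+1}}{2n+1}<(\ell-3)\log\varphi$, then $\alpha$ has only finitely many best lower approximations of the $\ell$-th kind. (ii) If $\limsup_{n\to\infty}\frac{\log a_{2n}}{2n}<(\ell-3)\log\varphi$, then $\alpha$ has only finitely many best upper approximations of the $\ell$-th kind.
   Context: $[a_0;a_1,a_2,\ldots]=a_0+\cfrac{1}{a_1+\cfrac{1}{a_2+\cdots}}$ is an infinite regular continued fraction. For $p\in\mathbb{Z}$, $q\in\mathbb{N}$, the fraction $\frac{p}{q}$ is a best lower approximation of the $\ell$-th kind to $\alpha$ if $0\le q^{\ell-1}(\alpha-\frac{p}{q})<(q')^{\ell-1}(\alpha-\frac{p'}{q'})$ for all $p'\in\mathbb{Z}$, $q'\in\mathbb{N}$ with $\frac{p'}{q'}\le\alpha$, $\frac{p'}{q'}\ne\frac{p}{q}$ and $q'\le q$; it is a best upper approximation of the $\ell$-th kind if $0\le q^{\ell-1}(\frac{p}{q}-\alpha)<(q')^{\ell-1}(\frac{p'}{q'}-\alpha)$ for all $p'\in\mathbb{Z}$, $q'\in\mathbb{N}$ with $\frac{p'}{q'}\ge\alpha$, $\frac{p'}{q'}\ne\frac{p}{q}$ and $q'\le q$. -}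

module Defs where

open import Data.Nat as ℕ using (ℕ; zero; suc; _∸_)
open import Data.Integer as ℤ using (ℤ; +_; -_; _+_; _*_; _-_; _^_)
open import Data.Product using (Σ; _×_; _,_; proj₁; proj₂; ∃)
open import Data.List using (List)
open import Data.List.Membership.Propositional using (_∈_)
open import Relation.Nullary using (¬_)
open import Relation.Binary.PropositionalEquality using (_≡_)

-- A continued fraction is given by its sequence of partial quotients
-- A 0 = a₀ ∈ ℤ, A n = aₙ (n ≥ 1, assumed positive where used).

-- pq A n = ((p_{n-1} , q_{n-1}) , (p_n , q_n)), the usual convergent recursion
-- p_{-1} = 1, q_{-1} = 0, p_0 = a₀, q_0 = 1,
-- p_n = a_n p_{n-1} + p_{n-2}, q_n = a_n q_{n-1} + q_{n-2}.
pq : (ℕ → ℤ) → ℕ → (ℤ × ℤ) × (ℤ × ℤ)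
pq A zero = ((+ 1 , + 0) , (A 0 , + 1))
pq A (suc n) with pq A n
... | ((p′ , q′) , (p , q)) = ((p , q) , (A (suc n) * p + p′ , A (suc n) * q + q′))

convP : (ℕ → ℤ) → ℕ → ℤ
convP A n = proj₁ (proj₂ (pq A n))

convQ : (ℕ → ℤ) → ℕ → ℤ
convQ A n = proj₂ (proj₂ (pq A n))

-- The real number α = [A 0; A 1, A 2, …] is the limit of its convergents and
-- lies strictly between any two consecutive convergents.  Since there are no
-- reals in the library, we access α only through linear (in)equalities
-- with integer coefficients:
--   Pos A c d  means   c·α + d > 0
-- (true iff the affine map x ↦ c x + d is positive at two consecutive
-- convergents p_n/q_n, p_{n+1}/q_{n+1}, q_n > 0).
Pos : (ℕ → ℤ) → ℤ → ℤ → Set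
Pos A c d = ∃ λ n → (+ 0 ℤ.< c * convP A n + d * convQ A n)
                  × (+ 0 ℤ.< c * convP A (suc n) + d * convQ A (suc n))

Nonneg : (ℕ → ℤ) → ℤ → ℤ → Set
Nonneg A c d = ¬ Pos A (- c) (- d)

pw : ℕ → ℕ → ℤ
pw q k = + (q ℕ.^ k)

-- p/q is a best lower approximation of the ℓ-th kind to α.
-- E(p,q) = q^{ℓ-1}(α - p/q) = q^{ℓ-1}·α - q^{ℓ-2}·p.
BestLower : (ℕ → ℤ) → ℕ → ℤ → ℕ → Set
BestLower A ℓ p q =
  (1 ℕ.≤ q)
  × Nonneg A (pw q (ℓ ∸ 1)) (- (pw q (ℓ ∸ 2) * p))
  × (∀ (p′ : ℤ) (q′ : ℕ) → 1 ℕ.≤ q′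
       → Nonneg A (+ q′) (- p′)                 -- p′/q′ ≤ α
       → ¬ (p′ * + q ≡ p * + q′)
       → q′ ℕ.≤ q
       → Pos A (pw q′ (ℓ ∸ 1) - pw q (ℓ ∸ 1))
               (pw q (ℓ ∸ 2) * p - pw q′ (ℓ ∸ 2) * p′))
                                                -- E(p,q) < E(p′,q′)

-- p/q is a best upper approximation of the ℓ-th kind to α.
-- F(p,q) = q^{ℓ-1}(p/q - α) = q^{ℓ-2}·p - q^{ℓ-1}·α.
BestUpper : (ℕ → ℤ) → ℕ → ℤ → ℕ → Set
BestUpper A ℓ p q =
  (1 ℕ.≤ q)
  × Nonneg A (- pw q (ℓ ∸ 1)) (pw q (ℓ ∸ 2) * p)
  × (∀ (p′ : ℤ) (q′ : ℕ) → 1 ℕ.≤ q′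
       → Nonneg A (- (+ q′)) p′                 -- p′/q′ ≥ α
       → ¬ (p′ * + q ≡ p * + q′)
       → q′ ℕ.≤ q
       → Pos A (pw q (ℓ ∸ 1) - pw q′ (ℓ ∸ 1))
               (pw q′ (ℓ ∸ 2) * p′ - pw q (ℓ ∸ 2) * p))
                                                -- F(p,q) < F(p′,q′)

Finitely : (ℤ → ℕ → Set) → Set
Finitely P = Σ (List (ℤ × ℕ)) λ L → ∀ p q → P p q → (p , q) ∈ L

-- u/v < φ = (1+√5)/2 for naturals u, v ≥ 1:  φ is the positive root of
-- x² = x + 1, so for x = u/v > 0, x < φ ⟺ u² < u v + v².
BelowPhi : ℕ → ℕ → Set
BelowPhi u v = (1 ℕ.≤ v) × (u ℕ.* u ℕ.< u ℕ.* v ℕ.+ v ℕ.* v)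

-- limsup_{n→∞} log a_{f n} / f n < k log φ,  encoded as:
-- there is a rational u/v < φ with a_{f n} ≤ (u/v)^{k · f n} for all large n.
LimsupBelow : (ℕ → ℤ) → (ℕ → ℕ) → ℕ → Set
LimsupBelow A f k =
  Σ ℕ λ u → Σ ℕ λ v → BelowPhi u v ×
    Σ ℕ λ N → ∀ n → N ℕ.≤ n →
      A (f n) * pw v (k ℕ.* f n) ℤ.≤ pw u (k ℕ.* f n)

module Submission where

-- Let p/q be a best lower approximation of the ℓ-th kind with q large.  Comparing
-- it with ⌊α⌋/1 and (⌊α⌋ - 1)/1 shows p/q ≥ ⌊α⌋, bounds q when p/q = ⌊α⌋, and
-- otherwise gives q^(ℓ-2) (q α - p) < α - ⌊α⌋ < 1.  Now p/q lies between two
-- even convergents, p₂ₙ/q₂ₙ < p/q ≤ p₂ₙ₊₂/q₂ₙ₊₂.  If p/q < p₂ₙ₊₂/q₂ₙ₊₂, then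
-- q α - p ≥ |q₂ₙ₊₁ α - p₂ₙ₊₁| ≥ 1/(q₂ₙ₊₁ + q₂ₙ₊₂) ≥ 1/(3q), contradicting ℓ ≥ 4.
-- If p/q = p₂ₙ₊₂/q₂ₙ₊₂, then q ≥ q₂ₙ₊₂ and q α - p ≥ 1/(q₂ₙ₊₂ + q₂ₙ₊₃)
-- ≥ 1/((a₂ₙ₊₃ + 2) q); as q₂ₙ₊₂ is at least a Fibonacci number, which grows like
-- φ^(2n), while a₂ₙ₊₃ ≤ (u/v)^((ℓ-3)(2n+3)) with u/v < φ, we get a₂ₙ₊₃ + 2 ≤ q^(ℓ-3)
-- for large q, a contradiction again.  Part (ii) is part (i) for -α, whose
-- convergents -pₘ/qₘ, preceded by -1/0, have the parities of their indices swapped.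
--
-- The real number α never appears: c α + d ≥ 0 is expressed through the signs of
-- c pₘ + d qₘ for large m, which satisfy the recurrence of the convergents.

open import Defs
open import Data.Nat as ℕ using (ℕ; zero; suc; z≤n; s≤s)
import Data.Nat.Properties as ℕP
import Data.Nat.Tactic.RingSolver as ℕSolver
open import Data.Integer as ℤ using (ℤ; +_; -_; -[1+_]; +≤+; +<+; 0ℤ; 1ℤ)
import Data.Integer.Properties as ℤP
open import Data.Integer.Tactic.RingSolver using (solve-∀)
open import Data.Product using (Σ; _×_; _,_; proj₁; proj₂)
open import Data.Sum using (_⊎_; inj₁; inj₂)
open import Data.Empty using (⊥; ⊥-elim)
open import Data.List using (map; cartesianProduct; upTo)
open import Data.List.Membership.Propositional using (_∈_)
open import Data.List.Membership.Propositional.Properties using (∈-map⁺; ∈-cartesianProduct⁺; ∈-upTo⁺)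
open import Relation.Nullary using (¬_; Dec; yes; no)
open import Relation.Binary.PropositionalEquality

-- Sign certificates and linear recurrences

module _ where
  open import Data.Integer using (_+_; _-_; _*_)

  -- Sign conditions are proved by certificates: an identity writing the quantity
  -- (minus 1, for strict positivity) as a sum of products of quantities already
  -- known to be nonnegative.

  0≤+ : ∀ n → 0ℤ ℤ.≤ + n
  0≤+ n = +≤+ z≤n

  0≤-+ : ∀ {x y} → 0ℤ ℤ.≤ x → 0ℤ ℤ.≤ y → 0ℤ ℤ.≤ x + y
  0≤-+ (+≤+ _) (+≤+ _) = +≤+ z≤n

  0≤-* : ∀ {x y} → 0ℤ ℤ.≤ x → 0ℤ ℤ.≤ y → 0ℤ ℤ.≤ x * y
  0≤-* {+ m} {+ n} _ _ = subst (0ℤ ℤ.≤_) (ℤP.pos-* m n) (0≤+ _)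

  0≤-by : ∀ {x y} → x ≡ y → 0ℤ ℤ.≤ y → 0ℤ ℤ.≤ x
  0≤-by x≡y = subst (0ℤ ℤ.≤_) (sym x≡y)

  1≤-by : ∀ {x y} → x - 1ℤ ≡ y → 0ℤ ℤ.≤ y → 1ℤ ℤ.≤ x
  1≤-by x-1≡y 0≤y = ℤP.0≤i-j⇒j≤i (0≤-by x-1≡y 0≤y)

  1≤⇒0≤ : ∀ {x} → 1ℤ ℤ.≤ x → 0ℤ ℤ.≤ x
  1≤⇒0≤ = ℤP.≤-trans (0≤+ 1)

  1≤⇒0≤-1 : ∀ {x} → 1ℤ ℤ.≤ x → 0ℤ ℤ.≤ x - 1ℤ
  1≤⇒0≤-1 = ℤP.i≤j⇒0≤j-i

  1≰0 : ¬ 1ℤ ℤ.≤ 0ℤ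
  1≰0 (+≤+ ())

  0≰-1 : ¬ 0ℤ ℤ.≤ - 1ℤ
  0≰-1 ()

  1≤∧0≤-⇒⊥ : ∀ {x} → 1ℤ ℤ.≤ x → 0ℤ ℤ.≤ - x → ⊥
  1≤∧0≤-⇒⊥ {+ zero} (+≤+ ()) _
  1≤∧0≤-⇒⊥ {+ suc n} _ ()

  ¬1≤⇒0≤- : ∀ x → ¬ 1ℤ ℤ.≤ x → 0ℤ ℤ.≤ - x
  ¬1≤⇒0≤- (+ zero) _ = 0≤+ 0
  ¬1≤⇒0≤- (+ suc n) h = ⊥-elim (h (+≤+ (s≤s z≤n)))
  ¬1≤⇒0≤- -[1+ n ] _ = 0≤+ (suc n)

  ¬0≤⇒1≤- : ∀ x → ¬ 0ℤ ℤ.≤ x → 1ℤ ℤ.≤ - x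
  ¬0≤⇒1≤- (+ n) h = ⊥-elim (h (0≤+ n))
  ¬0≤⇒1≤- -[1+ n ] _ = +≤+ (s≤s z≤n)

  0≤∧0≤-⇒≡0 : ∀ x → 0ℤ ℤ.≤ x → 0ℤ ℤ.≤ - x → x ≡ 0ℤ
  0≤∧0≤-⇒≡0 (+ zero) _ _ = refl

  1≤-* : ∀ {x y} → 1ℤ ℤ.≤ x → 1ℤ ℤ.≤ y → 1ℤ ℤ.≤ x * y
  1≤-* {x} {y} hx hy = 1≤-by (lemma x y) (0≤-+ (0≤-* (1≤⇒0≤-1 hx) (1≤⇒0≤ hy)) (1≤⇒0≤-1 hy))
    where lemma : ∀ x y → x * y - 1ℤ ≡ (x - 1ℤ) * y + (y - 1ℤ)
          lemma = solve-∀

  1≤-*-cancelˡ : ∀ {a x} → 0ℤ ℤ.≤ a → 1ℤ ℤ.≤ a * x → 1ℤ ℤ.≤ x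
  1≤-*-cancelˡ {a} {x} 0≤a 1≤ax with 1ℤ ℤP.≤? x
  ... | yes 1≤x = 1≤x
  ... | no 1≰x = ⊥-elim (1≤∧0≤-⇒⊥ 1≤ax (0≤-by (ℤP.neg-distribʳ-* a x) (0≤-* 0≤a (¬1≤⇒0≤- x 1≰x))))

  1≤-step : ∀ {a x₀ x₁} → 0ℤ ℤ.≤ a → 1ℤ ℤ.≤ x₀ → 0ℤ ℤ.≤ x₁ → 1ℤ ℤ.≤ a * x₁ + x₀
  1≤-step {a} {x₀} {x₁} 0≤a h₀ h₁ = 1≤-by (lemma a x₀ x₁) (0≤-+ (0≤-* 0≤a h₁) (1≤⇒0≤-1 h₀))
    where lemma : ∀ a x₀ x₁ → (a * x₁ + x₀) - 1ℤ ≡ a * x₁ + (x₀ - 1ℤ)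
          lemma = solve-∀

  0<⇒1≤ : ∀ {x} → 0ℤ ℤ.< x → 1ℤ ℤ.≤ x
  0<⇒1≤ (+<+ 0<n) = +≤+ 0<n

  1≤⇒0< : ∀ {x} → 1ℤ ℤ.≤ x → 0ℤ ℤ.< x
  1≤⇒0< (+≤+ 1≤n) = +<+ 1≤n

  -- Applied to X M = c P M + d Q M, this is Defs.Pos: c α + d > 0.
  Positive : (ℕ → ℤ) → Set
  Positive X = Σ ℕ λ m → 1ℤ ℤ.≤ X m × 1ℤ ℤ.≤ X (suc m)

  Positive-cong : ∀ {X Y} → (∀ M → X M ≡ Y M) → Positive X → Positive Y
  Positive-cong X≡Y (m , h₀ , h₁) = m , subst (1ℤ ℤ.≤_) (X≡Y m) h₀ , subst (1ℤ ℤ.≤_) (X≡Y (suc m)) h₁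

  module Recurrence (b : ℕ → ℤ) (b≥1 : ∀ m → 1ℤ ℤ.≤ b (suc (suc m))) where

    Recurrent : (ℕ → ℤ) → Set
    Recurrent X = ∀ m → X (suc (suc m)) ≡ b (suc (suc m)) * X (suc m) + X m

    Recurrent-cong : ∀ {X Y} → (∀ M → Y M ≡ X M) → Recurrent X → Recurrent Y
    Recurrent-cong {X} {Y} Y≡X rec m
      rewrite Y≡X (suc (suc m)) | Y≡X (suc m) | Y≡X m = rec m

    Recurrent-lincomb : ∀ {X Y} → Recurrent X → Recurrent Y →
                        ∀ x y → Recurrent (λ M → x * X M + y * Y M)
    Recurrent-lincomb {X} {Y} recX recY x y m rewrite recX m | recY m =
      lemma x y (b (suc (suc m))) (X (suc m)) (X m) (Y (suc m)) (Y m)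
      where
      lemma : ∀ x y a X₁ X₀ Y₁ Y₀ → x * (a * X₁ + X₀) + y * (a * Y₁ + Y₀) ≡
                                    a * (x * X₁ + y * Y₁) + (x * X₀ + y * Y₀)
      lemma = solve-∀

    b≥0 : ∀ m → 0ℤ ℤ.≤ b (suc (suc m))
    b≥0 m = 1≤⇒0≤ (b≥1 m)

    private
      from-offset : ∀ {R : ℕ → Set} {m} → (∀ d → R (d ℕ.+ m)) → ∀ {M} → m ℕ.≤ M → R M
      from-offset {R} {m} h {M} m≤M with ℕP.m≤n⇒∃[o]m+o≡n m≤M
      ... | d , m+d≡M = subst R (trans (ℕP.+-comm d m) m+d≡M) (h d)

    0≤-propagate : ∀ {X m} → Recurrent X → 0ℤ ℤ.≤ X m → 0ℤ ℤ.≤ X (suc m) →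
                   ∀ {M} → m ℕ.≤ M → 0ℤ ℤ.≤ X M
    0≤-propagate {X} {m} rec h₀ h₁ = from-offset {λ M → 0ℤ ℤ.≤ X M} (λ d → proj₁ (pair d))
      where
      pair : ∀ d → 0ℤ ℤ.≤ X (d ℕ.+ m) × 0ℤ ℤ.≤ X (suc d ℕ.+ m)
      pair zero = h₀ , h₁
      pair (suc d) with pair d
      ... | x₀ , x₁ = x₁ , 0≤-by (rec (d ℕ.+ m)) (0≤-+ (0≤-* (b≥0 (d ℕ.+ m)) x₁) x₀)

    1≤-propagate : ∀ {X m} → Recurrent X → 0ℤ ℤ.≤ X m → 1ℤ ℤ.≤ X (suc m) →
                   ∀ {M} → suc m ℕ.≤ M → 1ℤ ℤ.≤ X M
    1≤-propagate {X} {m} rec h₀ h₁ = from-offset {λ M → 1ℤ ℤ.≤ X M} (λ d → proj₁ (pair d))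
      where
      pair : ∀ d → 1ℤ ℤ.≤ X (d ℕ.+ suc m) × 1ℤ ℤ.≤ X (suc d ℕ.+ suc m)
      pair zero = h₁ , subst (1ℤ ℤ.≤_) (sym (rec m))
        (1≤-by (lemma (b (suc (suc m))) (X m) (X (suc m)))
               (0≤-+ (0≤-+ (0≤-* (1≤⇒0≤-1 (b≥1 m)) (1≤⇒0≤ h₁)) (1≤⇒0≤-1 h₁)) h₀))
        where lemma : ∀ a x₀ x₁ → (a * x₁ + x₀) - 1ℤ ≡ (a - 1ℤ) * x₁ + (x₁ - 1ℤ) + x₀
              lemma = solve-∀
      pair (suc d) with pair d
      ... | x₀ , x₁ = x₁ , subst (1ℤ ℤ.≤_) (sym (rec (d ℕ.+ suc m)))
                               (1≤-step (b≥0 (d ℕ.+ suc m)) x₀ (1≤⇒0≤ x₁))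

    Positive⇒¬eventually-nonpositive : ∀ {X} → Recurrent X → Positive X →
                                        ∀ N → ¬ (∀ M → N ℕ.≤ M → 0ℤ ℤ.≤ - X M)
    Positive⇒¬eventually-nonpositive rec (m , h₀ , h₁) N nonpos =
      1≤∧0≤-⇒⊥ (1≤-propagate rec (1≤⇒0≤ h₀) h₁ (ℕP.m≤n⊔m N (suc m)))
               (nonpos (N ℕ.⊔ suc m) (ℕP.m≤m⊔n N (suc m)))

  crossing : ∀ {R : ℕ → Set} → (∀ n → Dec (R n)) → R 0 → ∀ N → ¬ R N →
             Σ ℕ λ n → R n × ¬ R (suc n)
  crossing R? R0 zero ¬RN = ⊥-elim (¬RN R0)
  crossing R? R0 (suc N) ¬RN with R? N
  ... | yes RN = N , RN , ¬RN
  ... | no ¬RN′ = crossing R? R0 N ¬RN′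

-- Fibonacci numbers

module _ where
  open import Data.Integer using (_+_; _-_; _*_)

  -- fib m = F (m + 1), the least possible denominator of the m-th convergent.
  fib : ℕ → ℕ
  fib zero = 1
  fib (suc zero) = 1
  fib (suc (suc m)) = fib (suc m) ℕ.+ fib m

  fib≥1 : ∀ m → 1 ℕ.≤ fib m
  fib≥1 zero = s≤s z≤n
  fib≥1 (suc zero) = s≤s z≤n
  fib≥1 (suc (suc m)) = ℕP.≤-trans (fib≥1 (suc m)) (ℕP.m≤m+n _ _)

  fib-mono : ∀ m → fib m ℕ.≤ fib (suc m)
  fib-mono zero = ℕP.≤-refl
  fib-mono (suc m) = ℕP.m≤m+n _ _

  m≤fib : ∀ m → m ℕ.≤ fib m
  m≤fib zero = z≤n
  m≤fib (suc zero) = s≤s z≤n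
  m≤fib (suc (suc m)) = ℕP.≤-trans (ℕP.≤-reflexive (ℕP.+-comm 1 (suc m)))
                                   (ℕP.+-mono-≤ (m≤fib (suc m)) (fib≥1 m))

  private
    cassini-form : ℕ → ℤ
    cassini-form m = let a = + fib (suc m); b = + fib m in a * a - a * b - b * b

    cassini-form-suc : ∀ m → cassini-form (suc m) ≡ - cassini-form m
    cassini-form-suc m = lemma (+ fib (suc m)) (+ fib m)
      where lemma : ∀ a b → (a + b) * (a + b) - (a + b) * a - a * a ≡ - (a * a - a * b - b * b)
            lemma = solve-∀

    cassini-form-±1 : ∀ m → cassini-form m ≡ 1ℤ ⊎ cassini-form m ≡ - 1ℤ
    cassini-form-±1 zero = inj₂ refl
    cassini-form-±1 (suc m) with cassini-form-±1 m
    ... | inj₁ eq = inj₂ (trans (cassini-form-suc m) (cong -_ eq))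
    ... | inj₂ eq = inj₁ (trans (cassini-form-suc m) (cong -_ eq))

  cassini : ∀ m → let a = + fib (suc m); b = + fib m in
            0ℤ ℤ.≤ a * a + 1ℤ - a * b - b * b
  cassini m = 0≤-by (lemma (+ fib (suc m)) (+ fib m)) (shift (cassini-form-±1 m))
    where
    lemma : ∀ a b → a * a + 1ℤ - a * b - b * b ≡ (a * a - a * b - b * b) + 1ℤ
    lemma = solve-∀
    shift : cassini-form m ≡ 1ℤ ⊎ cassini-form m ≡ - 1ℤ → 0ℤ ℤ.≤ cassini-form m + 1ℤ
    shift (inj₁ eq) rewrite eq = 0≤+ 2
    shift (inj₂ eq) rewrite eq = 0≤+ 0

  -- a/b ≥ u/v, because t ↦ t² - t - 1 increases for t ≥ 1/2 and
  -- (a/b)² - a/b - 1 ≥ -1/b² ≥ -1/v² ≥ (u/v)² - u/v - 1.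
  ratio-comparison : ∀ a b u v → 0ℤ ℤ.≤ a * a + 1ℤ - a * b - b * b →
                     0ℤ ℤ.≤ u * v + v * v - u * u - 1ℤ →
                     0ℤ ℤ.≤ a - b → 0ℤ ℤ.≤ b - v → 1ℤ ℤ.≤ u → 1ℤ ℤ.≤ v →
                     0ℤ ℤ.≤ a * v - u * b
  ratio-comparison a b u v cas below a≥b b≥v u≥1 v≥1 with 0ℤ ℤP.≤? a * v - u * b
  ... | yes h = h
  ... | no h = ⊥-elim (0≰-1 (0≤-by (lemma a b u v)
        (0≤-+ (0≤-+ (0≤-+ (0≤-+ (0≤-+ (0≤-* (1≤⇒0≤-1 (¬0≤⇒1≤- _ h))
                                              (0≤-+ (0≤-* (1≤⇒0≤ u≥1) b≥0) (0≤-* a≥b v≥0)))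
                                       (0≤-* (0≤-* v≥0 v≥0) cas))
                                (0≤-* (0≤-* b≥0 b≥0) below))
                         (0≤-+ (0≤-* (1≤⇒0≤-1 u≥1) b≥0) (0≤-+ b≥v (1≤⇒0≤-1 v≥1))))
                  (0≤-* a≥b v≥0))
              (0≤-* b≥v (0≤-+ b≥0 v≥0)))))
    where
    v≥0 : 0ℤ ℤ.≤ v
    v≥0 = 1≤⇒0≤ v≥1
    b≥0 : 0ℤ ℤ.≤ b
    b≥0 = 0≤-by (lemma₀ b v) (0≤-+ b≥v v≥0)
      where lemma₀ : ∀ b v → b ≡ (b - v) + v
            lemma₀ = solve-∀
    lemma : ∀ a b u v → - 1ℤ ≡
        (((((- (a * v - u * b) - 1ℤ) * (u * b + (a - b) * v)
           + v * v * (a * a + 1ℤ - a * b - b * b))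
           + b * b * (u * v + v * v - u * u - 1ℤ))
           + ((u - 1ℤ) * b + ((b - v) + (v - 1ℤ))))
           + (a - b) * v)
           + (b - v) * (b + v)
    lemma = solve-∀

  BelowPhiℤ : ℕ → ℕ → Set
  BelowPhiℤ u v = 0ℤ ℤ.≤ + u * + v + + v * + v - + u * + u - 1ℤ

  BelowPhi⇒BelowPhiℤ : ∀ {u v} → BelowPhi u v → BelowPhiℤ u v
  BelowPhi⇒BelowPhiℤ {u} {v} (_ , u²<uv+v²) =
    0≤-by (sym (trans (cong₂ (λ x y → x - (1ℤ + y)) (trans (ℤP.pos-+ (u ℕ.* v) (v ℕ.* v))
                                                        (cong₂ _+_ (ℤP.pos-* u v) (ℤP.pos-* v v)))
                                                 (ℤP.pos-* u u))
                 (lemma (+ u * + v + + v * + v) (+ u * + u))))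
          (ℤP.i≤j⇒0≤j-i (+≤+ u²<uv+v²))
    where lemma : ∀ x y → x - (1ℤ + y) ≡ x - y - 1ℤ
          lemma = solve-∀

  BelowPhiℤ-refine : ∀ {u v} → 1 ℕ.≤ v → BelowPhiℤ u v →
                     let N = suc (u ℕ.+ u) in BelowPhiℤ (suc (u ℕ.* N)) (v ℕ.* N)
  BelowPhiℤ-refine {u} {v} 1≤v below =
    subst₂ (λ x y → 0ℤ ℤ.≤ x * y + y * y - x * x - 1ℤ) (sym u′≡) (sym v′≡)
      (0≤-by (lemma (+ u) (+ v))
        (0≤-+ (0≤-+ (0≤-+ (0≤-* (0≤-* (0≤+ N) (0≤+ N)) below) (0≤+ (u ℕ.+ u)))
                    (0≤-* (1≤⇒0≤-1 (+≤+ 1≤v)) (0≤+ N)))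
              (0≤+ (u ℕ.+ u))))
    where
    N : ℕ
    N = suc (u ℕ.+ u)
    u′≡ : + suc (u ℕ.* N) ≡ 1ℤ + + u * (1ℤ + (+ u + + u))
    u′≡ = cong (λ x → 1ℤ + x) (trans (ℤP.pos-* u N) (cong (λ x → + u * (1ℤ + x)) (ℤP.pos-+ u u)))
    v′≡ : + (v ℕ.* N) ≡ + v * (1ℤ + (+ u + + u))
    v′≡ = trans (ℤP.pos-* v N) (cong (λ x → + v * (1ℤ + x)) (ℤP.pos-+ u u))
    lemma : ∀ u v →
      (1ℤ + u * (1ℤ + (u + u))) * (v * (1ℤ + (u + u))) + (v * (1ℤ + (u + u))) * (v * (1ℤ + (u + u)))
        - (1ℤ + u * (1ℤ + (u + u))) * (1ℤ + u * (1ℤ + (u + u))) - 1ℤ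
      ≡ (1ℤ + (u + u)) * (1ℤ + (u + u)) * (u * v + v * v - u * u - 1ℤ) + (u + u)
        + (v - 1ℤ) * (1ℤ + (u + u)) + (u + u)
    lemma = solve-∀

-- Growth of Fibonacci numbers

module _ where
  open import Data.Nat using (_+_; _*_; _^_; _≤_; _<_; _⊔_; NonZero)
  open ℕP using (≤-trans; ≤-reflexive; *-monoˡ-≤; *-monoʳ-≤; module ≤-Reasoning)

  ^-distribʳ-* : ∀ m n o → (m * n) ^ o ≡ m ^ o * n ^ o
  ^-distribʳ-* m n zero = refl
  ^-distribʳ-* m n (suc o) rewrite ^-distribʳ-* m n o = lemma m n (m ^ o) (n ^ o)
    where lemma : ∀ m n x y → m * n * (x * y) ≡ m * x * (n * y)
          lemma = ℕSolver.solve-∀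

  fib-ratio-step : ∀ {u v} m → 1 ≤ u → 1 ≤ v → BelowPhiℤ u v → v ≤ fib m →
                   u * fib m ≤ fib (suc m) * v
  fib-ratio-step {u} {v} m 1≤u 1≤v below v≤fib =
    ℤP.drop‿+≤+ (subst₂ ℤ._≤_ (sym (ℤP.pos-* u (fib m))) (sym (ℤP.pos-* (fib (suc m)) v))
      (ℤP.0≤i-j⇒j≤i (ratio-comparison (+ fib (suc m)) (+ fib m) (+ u) (+ v) (cassini m) below
        (ℤP.i≤j⇒0≤j-i (+≤+ (fib-mono m))) (ℤP.i≤j⇒0≤j-i (+≤+ v≤fib)) (+≤+ 1≤u) (+≤+ 1≤v))))

  fib-ratio-iterate : ∀ {u v} → 1 ≤ u → 1 ≤ v → BelowPhiℤ u v →
                      ∀ j → u ^ j * fib v ≤ fib (j + v) * v ^ j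
  fib-ratio-iterate _ _ _ zero = ≤-reflexive (ℕP.*-comm 1 _)
  fib-ratio-iterate {u} {v} 1≤u 1≤v below (suc j) = begin
    u * u ^ j * fib v        ≡⟨ ℕP.*-assoc u (u ^ j) (fib v) ⟩
    u * (u ^ j * fib v)      ≤⟨ *-monoʳ-≤ u (fib-ratio-iterate 1≤u 1≤v below j) ⟩
    u * (fib (j + v) * v ^ j) ≡⟨ ℕP.*-assoc u (fib (j + v)) (v ^ j) ⟨
    u * fib (j + v) * v ^ j  ≤⟨ *-monoˡ-≤ (v ^ j) (fib-ratio-step (j + v) 1≤u 1≤v below
                                   (≤-trans (ℕP.m≤n+m v j) (m≤fib (j + v)))) ⟩
    fib (suc j + v) * v * v ^ j ≡⟨ ℕP.*-assoc (fib (suc j + v)) v (v ^ j) ⟩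
    fib (suc j + v) * (v * v ^ j) ∎
    where open ≤-Reasoning

  bernoulli : ∀ x j → x ^ j * (x + j) ≤ x * suc x ^ j
  bernoulli x zero = ≤-reflexive (trans (ℕP.*-identityˡ (x + 0)) (trans (ℕP.+-identityʳ x) (sym (ℕP.*-identityʳ x))))
  bernoulli x (suc j) = begin
    x * x ^ j * (x + suc j)             ≤⟨ ℕP.m≤m+n _ (x ^ j * j) ⟩
    x * x ^ j * (x + suc j) + x ^ j * j ≡⟨ lemma x j (x ^ j) ⟩
    suc x * (x ^ j * (x + j))           ≤⟨ *-monoʳ-≤ (suc x) (bernoulli x j) ⟩
    suc x * (x * suc x ^ j)             ≡⟨ lemma′ x (suc x ^ j) ⟩
    x * (suc x * suc x ^ j)             ∎
    where
    open ≤-Reasoning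
    lemma : ∀ x j p → x * p * (x + suc j) + p * j ≡ suc x * (p * (x + j))
    lemma = ℕSolver.solve-∀
    lemma′ : ∀ x y → suc x * (x * y) ≡ x * (suc x * y)
    lemma′ = ℕSolver.solve-∀

  *^≤suc^ : ∀ C x .{{_ : NonZero x}} j → x * C ≤ j → C * x ^ j ≤ suc x ^ j
  *^≤suc^ C x j xC≤j = ℕP.*-cancelˡ-≤ x (begin
    x * (C * x ^ j)  ≡⟨ lemma x C (x ^ j) ⟩
    x ^ j * (x * C)  ≤⟨ *-monoʳ-≤ (x ^ j) (≤-trans xC≤j (ℕP.m≤n+m j x)) ⟩
    x ^ j * (x + j)  ≤⟨ bernoulli x j ⟩
    x * suc x ^ j    ∎)
    where
    open ≤-Reasoning
    lemma : ∀ x C p → x * (C * p) ≡ p * (x * C)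
    lemma = ℕSolver.solve-∀

  -- Since u/v < (uN + 1)/(vN) < φ, the quotient fib m v^m / u^m eventually grows
  -- like ((uN + 1)/(uN))^m, which beats any constant.
  fib-dominates : ∀ {u v} → 1 ≤ u → BelowPhi u v → ∀ C →
                  Σ ℕ λ m₀ → ∀ m → m₀ ≤ m → C * u ^ m ≤ fib m * v ^ m
  fib-dominates {u} {v} 1≤u bp@(1≤v , _) C = X * C′ + v′ , eventually
    where
    N X v′ C′ : ℕ
    N = suc (u + u)
    X = u * N
    v′ = v * N
    C′ = C * u ^ v′
    instance
      X≢0 : NonZero X
      X≢0 = ℕ.>-nonZero (ℕP.*-mono-≤ 1≤u (s≤s z≤n))
    1≤v′ : 1 ≤ v′
    1≤v′ = ℕP.*-mono-≤ 1≤v (s≤s z≤n)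
    below′ : BelowPhiℤ (suc X) v′
    below′ = BelowPhiℤ-refine {u} {v} 1≤v (BelowPhi⇒BelowPhiℤ {u} {v} bp)
    bound : ∀ j → X * C′ ≤ j → C * u ^ (j + v′) ≤ fib (j + v′) * v ^ (j + v′)
    bound j XC′≤j = ℕP.*-cancelʳ-≤ _ _ (N ^ j) {{ℕP.m^n≢0 N j}} (begin
      C * u ^ (j + v′) * N ^ j                ≡⟨ cong (λ x → C * x * N ^ j) (ℕP.^-distribˡ-+-* u j v′) ⟩
      C * (u ^ j * u ^ v′) * N ^ j            ≡⟨ lemma₁ C (u ^ j) (u ^ v′) (N ^ j) ⟩
      C′ * (u ^ j * N ^ j)                    ≡⟨ cong (C′ *_) (^-distribʳ-* u N j) ⟨
      C′ * X ^ j                              ≤⟨ *^≤suc^ C′ X j XC′≤j ⟩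
      suc X ^ j                               ≤⟨ ℕP.m≤m*n (suc X ^ j) (fib v′) {{ℕ.>-nonZero (fib≥1 v′)}} ⟩
      suc X ^ j * fib v′                      ≤⟨ fib-ratio-iterate (s≤s z≤n) 1≤v′ below′ j ⟩
      F * v′ ^ j                              ≡⟨ cong (F *_) (^-distribʳ-* v N j) ⟩
      F * (v ^ j * N ^ j)                     ≤⟨ *-monoʳ-≤ F (*-monoˡ-≤ (N ^ j) (ℕP.m≤m*n (v ^ j) (v ^ v′)
                                                   {{ℕP.m^n≢0 v v′ {{ℕ.>-nonZero 1≤v}}}})) ⟩
      F * (v ^ j * v ^ v′ * N ^ j)            ≡⟨ lemma₂ F (v ^ j * v ^ v′) (N ^ j) ⟩
      F * (v ^ j * v ^ v′) * N ^ j            ≡⟨ cong (λ x → F * x * N ^ j) (ℕP.^-distribˡ-+-* v j v′) ⟨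
      F * v ^ (j + v′) * N ^ j                ∎)
      where
      open ≤-Reasoning
      F : ℕ
      F = fib (j + v′)
      lemma₁ : ∀ C a b n → C * (a * b) * n ≡ C * b * (a * n)
      lemma₁ = ℕSolver.solve-∀
      lemma₂ : ∀ F a n → F * (a * n) ≡ F * a * n
      lemma₂ = ℕSolver.solve-∀
    eventually : ∀ m → X * C′ + v′ ≤ m → C * u ^ m ≤ fib m * v ^ m
    eventually m m₀≤m with ℕP.m≤n⇒∃[o]m+o≡n m₀≤m
    ... | d , refl = subst (λ m → C * u ^ m ≤ fib m * v ^ m) (lemma (X * C′) v′ d)
                           (bound (X * C′ + d) (ℕP.m≤m+n _ d))
      where lemma : ∀ a b c → a + c + b ≡ a + b + c
            lemma = ℕSolver.solve-∀

  BelowPhi-⊔ : ∀ {u v} → BelowPhi u v → BelowPhi (u ⊔ v) v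
  BelowPhi-⊔ {u} {v} bp@(1≤v , _) with ℕP.≤-total u v
  ... | inj₁ u≤v rewrite ℕP.m≤n⇒m⊔n≡n u≤v = 1≤v , ℕP.m<m+n (v * v) (ℕP.*-mono-≤ 1≤v 1≤v)
  ... | inj₂ v≤u rewrite ℕP.m≥n⇒m⊔n≡m v≤u = bp

  quotient-bound : ∀ {u v} k → BelowPhi u v → Σ ℕ λ m₀ →
                   ∀ {a i m q} → m₀ ≤ m → m ≤ i → i ≤ 2 + m →
                   a * v ^ (suc k * i) ≤ u ^ (suc k * i) → fib m ≤ q → a + 2 ≤ q ^ suc k
  quotient-bound {u} {v} k bp@(1≤v , _) = m₀ , bound
    where
    U K : ℕ
    U = u ⊔ v
    K = suc k
    v≤U : v ≤ U
    v≤U = ℕP.m≤n⊔m u v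
    1≤U : 1 ≤ U
    1≤U = ≤-trans 1≤v v≤U
    instance
      U≢0 : NonZero U
      U≢0 = ℕ.>-nonZero 1≤U
      v≢0 : NonZero v
      v≢0 = ℕ.>-nonZero 1≤v
    dominated : Σ ℕ λ m₀ → ∀ m → m₀ ≤ m → 3 * (U * U) * U ^ m ≤ fib m * v ^ m
    dominated = fib-dominates 1≤U (BelowPhi-⊔ {u} {v} bp) (3 * (U * U))
    m₀ : ℕ
    m₀ = proj₁ dominated
    ^-reassoc : ∀ x i → (x ^ i) ^ K ≡ x ^ (K * i)
    ^-reassoc x i = trans (ℕP.^-*-assoc x i K) (cong (x ^_) (ℕP.*-comm i K))
    bound : ∀ {a i m q} → m₀ ≤ m → m ≤ i → i ≤ 2 + m →
            a * v ^ (K * i) ≤ u ^ (K * i) → fib m ≤ q → a + 2 ≤ q ^ K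
    bound {a} {i} {m} {q} m₀≤m m≤i i≤2+m a≤ fib≤q =
      ℕP.*-cancelʳ-≤ _ _ (v ^ (K * i)) {{ℕP.m^n≢0 v (K * i)}} (begin
        (a + 2) * v ^ (K * i)                 ≡⟨ ℕP.*-distribʳ-+ (v ^ (K * i)) a 2 ⟩
        a * v ^ (K * i) + 2 * v ^ (K * i)     ≤⟨ ℕP.+-mono-≤ (≤-trans a≤ (ℕP.^-monoˡ-≤ (K * i) (ℕP.m≤m⊔n u v)))
                                                           (*-monoʳ-≤ 2 (ℕP.^-monoˡ-≤ (K * i) v≤U)) ⟩
        U ^ (K * i) + 2 * U ^ (K * i)         ≡⟨ cong (λ x → x + 2 * x) (^-reassoc U i) ⟨
        (U ^ i) ^ K + 2 * (U ^ i) ^ K         ≡⟨⟩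
        3 * (U ^ i) ^ K                       ≤⟨ *-monoˡ-≤ ((U ^ i) ^ K) (ℕP.m≤m*n 3 (3 ^ k) {{ℕP.m^n≢0 3 k}}) ⟩
        3 ^ K * (U ^ i) ^ K                   ≡⟨ ^-distribʳ-* 3 (U ^ i) K ⟨
        (3 * U ^ i) ^ K                       ≤⟨ ℕP.^-monoˡ-≤ K 3U^i≤qv^i ⟩
        (q * v ^ i) ^ K                       ≡⟨ ^-distribʳ-* q (v ^ i) K ⟩
        q ^ K * (v ^ i) ^ K                   ≡⟨ cong (q ^ K *_) (^-reassoc v i) ⟩
        q ^ K * v ^ (K * i)                   ∎)
      where
      open ≤-Reasoning
      3U^i≤qv^i : 3 * U ^ i ≤ q * v ^ i
      3U^i≤qv^i = begin
        3 * U ^ i             ≤⟨ *-monoʳ-≤ 3 (ℕP.^-monoʳ-≤ U i≤2+m) ⟩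
        3 * (U * (U * U ^ m)) ≡⟨ lemma U (U ^ m) ⟩
        3 * (U * U) * U ^ m   ≤⟨ proj₂ dominated m m₀≤m ⟩
        fib m * v ^ m         ≤⟨ ℕP.*-mono-≤ fib≤q (ℕP.^-monoʳ-≤ v m≤i) ⟩
        q * v ^ i             ∎
        where lemma : ∀ U x → 3 * (U * (U * x)) ≡ 3 * (U * U) * x
              lemma = ℕSolver.solve-∀

  double : ℕ → ℕ
  double zero = zero
  double (suc n) = suc (suc (double n))

  double≡2* : ∀ n → double n ≡ 2 * n
  double≡2* zero = refl
  double≡2* (suc n) = trans (cong (λ x → suc (suc x)) (double≡2* n)) (lemma n)
    where lemma : ∀ n → 2 + 2 * n ≡ 2 * suc n
          lemma = ℕSolver.solve-∀

  n≤double : ∀ n → n ≤ double n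
  n≤double zero = z≤n
  n≤double (suc n) = s≤s (ℕP.m≤n⇒m≤1+n (n≤double n))

  maxBelow : (ℕ → ℕ) → ℕ → ℕ
  maxBelow g zero = 0
  maxBelow g (suc n) = maxBelow g n ⊔ g n

  ≤-maxBelow : ∀ g {n M} → n < M → g n ≤ maxBelow g M
  ≤-maxBelow g {n} {suc M} (s≤s n≤M) with ℕP.m≤n⇒m<n∨m≡n n≤M
  ... | inj₁ n<M = ≤-trans (≤-maxBelow g n<M) (ℕP.m≤m⊔n _ _)
  ... | inj₂ refl = ℕP.m≤n⊔m _ _

  small-quotients : ∀ {A f} k → (∀ n → 0ℤ ℤ.≤ A (f (suc n))) →
                    (∀ n → suc (double n) ≤ f (suc n)) → (∀ n → f (suc n) ≤ 3 + double n) →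
                    LimsupBelow A f (suc k) →
                    Σ ℕ λ B → ∀ n q → fib (suc (double n)) ≤ q → B < q →
                              A (f (suc n)) ℤ.+ + 2 ℤ.≤ + (q ^ suc k)
  small-quotients {A} {f} k A≥0 f-lower f-upper (u , v , bp , N , A≤) =
    suc (maxBelow a n₁ + 2) , bound
    where
    a : ℕ → ℕ
    a n = ℤ.∣ A (f (suc n)) ∣
    A≡a : ∀ n → A (f (suc n)) ≡ + a n
    A≡a n = sym (ℤP.0≤i⇒+∣i∣≡i (A≥0 n))
    large : Σ ℕ λ m₀ → ∀ {a i m q} → m₀ ≤ m → m ≤ i → i ≤ 2 + m →
                       a * v ^ (suc k * i) ≤ u ^ (suc k * i) → fib m ≤ q → a + 2 ≤ q ^ suc k
    large = quotient-bound k bp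
    n₁ : ℕ
    n₁ = N ⊔ proj₁ large
    bound : ∀ n q → fib (suc (double n)) ≤ q → suc (maxBelow a n₁ + 2) < q →
            A (f (suc n)) ℤ.+ + 2 ℤ.≤ + (q ^ suc k)
    bound n q fib≤q B<q rewrite A≡a n with n ℕ.<? n₁
    ... | yes n<n₁ = +≤+ (≤-trans (ℕP.+-monoˡ-≤ 2 (≤-maxBelow a n<n₁))
                                  (≤-trans (ℕP.<⇒≤ (ℕP.<-trans (ℕP.n<1+n _) B<q))
                                           (ℕP.m≤m*n q (q ^ k) {{ℕP.m^n≢0 q k {{q≢0}}}})))
      where q≢0 : NonZero q
            q≢0 = ℕ.>-nonZero (ℕP.<-≤-trans (s≤s z≤n) (ℕP.<⇒≤ B<q))
    ... | no n≮n₁ = +≤+ (proj₂ large (ℕP.≤-trans (ℕP.m≤n⊔m N _) (≤-trans n₁≤n (ℕP.m≤n⇒m≤1+n (n≤double n))))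
                                     (f-lower n) (f-upper n) a≤ fib≤q)
      where
      n₁≤n : n₁ ≤ n
      n₁≤n = ℕP.≮⇒≥ n≮n₁
      a≤ : a n * v ^ (suc k * f (suc n)) ≤ u ^ (suc k * f (suc n))
      a≤ = ℤP.drop‿+≤+ (subst (ℤ._≤ pw u (suc k * f (suc n)))
                               (trans (cong (ℤ._* pw v (suc k * f (suc n))) (A≡a n)) (sym (ℤP.pos-* (a n) _)))
                               (A≤ (suc n) (ℕP.m≤n⇒m≤1+n (≤-trans (ℕP.m≤m⊔n N _) n₁≤n))))

-- Convergents

module _ where
  open import Data.Integer using (_+_; _-_; _*_)

  -- P M / Q M play the role of the convergents of a real number α.
  module Convergents (b : ℕ → ℤ) (b≥1 : ∀ m → 1ℤ ℤ.≤ b (suc (suc m)))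
    (P Q : ℕ → ℤ) (recP : Recurrence.Recurrent b b≥1 P) (recQ : Recurrence.Recurrent b b≥1 Q)
    (Q₀≥0 : 0ℤ ℤ.≤ Q 0) (Q₁≥1 : 1ℤ ℤ.≤ Q 1) (det₀ : Q 0 * P 1 - P 0 * Q 1 ≡ 1ℤ) where

    open Recurrence b b≥1

    Q≥1 : ∀ m → 1ℤ ℤ.≤ Q (suc m)
    Q≥1 m = 1≤-propagate recQ Q₀≥0 Q₁≥1 (s≤s z≤n)

    Q≥0 : ∀ m → 0ℤ ℤ.≤ Q m
    Q≥0 zero = Q₀≥0
    Q≥0 (suc m) = 1≤⇒0≤ (Q≥1 m)

    Q-mono : ∀ m → 0ℤ ℤ.≤ Q (suc (suc m)) - Q (suc m)
    Q-mono m = 0≤-by (trans (cong (_- Q (suc m)) (recQ m)) (lemma (b (suc (suc m))) (Q m) (Q (suc m))))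
                     (0≤-+ (0≤-* (1≤⇒0≤-1 (b≥1 m)) (Q≥0 (suc m))) (Q≥0 m))
      where lemma : ∀ a x₀ x₁ → (a * x₁ + x₀) - x₁ ≡ (a - 1ℤ) * x₁ + x₀
            lemma = solve-∀

    Q≥fib : ∀ m → + fib m ℤ.≤ Q (suc m)
    Q≥fib zero = Q₁≥1
    Q≥fib (suc zero) = ℤP.≤-trans Q₁≥1 (ℤP.0≤i-j⇒j≤i (Q-mono 0))
    Q≥fib (suc (suc m)) = ℤP.0≤i-j⇒j≤i (0≤-by
      (trans (cong (_- (+ fib (suc m) + + fib m)) (recQ (suc m)))
             (lemma (b (suc (suc (suc m)))) (Q (suc m)) (Q (suc (suc m))) (+ fib (suc m)) (+ fib m)))
      (0≤-+ (0≤-+ (0≤-* (1≤⇒0≤-1 (b≥1 (suc m))) (Q≥0 (suc (suc m))))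
                  (ℤP.i≤j⇒0≤j-i (Q≥fib (suc m))))
            (ℤP.i≤j⇒0≤j-i (Q≥fib m))))
      where lemma : ∀ a x₀ x₁ F₁ F₀ → (a * x₁ + x₀) - (F₁ + F₀) ≡ ((a - 1ℤ) * x₁ + (x₁ - F₁)) + (x₀ - F₀)
            lemma = solve-∀

    det : ℕ → ℤ
    det m = Q m * P (suc m) - P m * Q (suc m)

    det-suc : ∀ m → det (suc m) ≡ - det m
    det-suc m rewrite recP m | recQ m = lemma (b (suc (suc m))) (P m) (P (suc m)) (Q m) (Q (suc m))
      where lemma : ∀ a P₀ P₁ Q₀ Q₁ → Q₁ * (a * P₁ + P₀) - P₁ * (a * Q₁ + Q₀) ≡ - (Q₀ * P₁ - P₀ * Q₁)
            lemma = solve-∀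

    det-even : ∀ n → det (double n) ≡ 1ℤ
    det-even zero = det₀
    det-even (suc n) rewrite det-suc (suc (double n)) | det-suc (double n) | det-even n = refl

    det-odd : ∀ n → det (suc (double n)) ≡ - 1ℤ
    det-odd n rewrite det-suc (double n) | det-even n = refl

    cross : ℕ → ℕ → ℤ
    cross κ M = Q κ * P M - P κ * Q M

    Recurrent-cross : ∀ κ x → Recurrent (λ M → x * cross κ M)
    Recurrent-cross κ x = Recurrent-cong (λ M → lemma x (Q κ) (P κ) (P M) (Q M))
                                         (Recurrent-lincomb recP recQ (x * Q κ) (- (x * P κ)))
      where lemma : ∀ x Qκ Pκ PM QM → x * (Qκ * PM - Pκ * QM) ≡ (x * Qκ) * PM + (- (x * Pκ)) * QM
            lemma = solve-∀

    -- For ε = (-1)^κ, in the limit: ε (Q κ α - P κ) ≥ 0 and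
    -- (Q κ + Q (κ + 1)) · ε (Q κ α - P κ) ≥ 1.
    module _ (κ : ℕ) (ε : ℤ) (ε-det : ε * det κ ≡ 1ℤ) where

      private
        X : ℕ → ℤ
        X M = ε * cross κ M

        Xκ≡0 : X κ ≡ 0ℤ
        Xκ≡0 = trans (cong (ε *_) (lemma (Q κ) (P κ))) (ℤP.*-zeroʳ ε)
          where lemma : ∀ x y → x * y - y * x ≡ 0ℤ
                lemma = solve-∀

      cross-sign : ∀ {M} → κ ℕ.≤ M → 0ℤ ℤ.≤ ε * cross κ M
      cross-sign = 0≤-propagate (Recurrent-cross κ ε) (subst (0ℤ ℤ.≤_) (sym Xκ≡0) (0≤+ 0))
                                (subst (0ℤ ℤ.≤_) (sym ε-det) (0≤+ 1))

      cross-bound : ∀ {M} → suc κ ℕ.≤ M → 0ℤ ℤ.≤ (Q κ + Q (suc κ)) * (ε * cross κ M) - Q M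
      cross-bound = 0≤-propagate rec (subst (0ℤ ℤ.≤_) (sym at₁) (Q≥0 κ))
                                     (subst (0ℤ ℤ.≤_) (sym at₂) (0≤-* (1≤⇒0≤-1 (b≥1 κ)) (Q≥0 κ)))
        where
        C : ℤ
        C = Q κ + Q (suc κ)
        rec : Recurrent (λ M → C * X M - Q M)
        rec = Recurrent-cong (λ M → lemma C (X M) (Q M)) (Recurrent-lincomb (Recurrent-cross κ ε) recQ C (- 1ℤ))
          where lemma : ∀ C x y → C * x - y ≡ C * x + (- 1ℤ) * y
                lemma = solve-∀
        at₁ : C * X (suc κ) - Q (suc κ) ≡ Q κ
        at₁ = trans (cong (λ x → C * x - Q (suc κ)) ε-det) (lemma (Q κ) (Q (suc κ)))
          where lemma : ∀ x y → (x + y) * 1ℤ - y ≡ x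
                lemma = solve-∀
        at₂ : C * X (suc (suc κ)) - Q (suc (suc κ)) ≡ (b (suc (suc κ)) - 1ℤ) * Q κ
        at₂ = trans (cong₂ (λ x y → C * x - y)
                           (trans (Recurrent-cross κ ε κ) (cong₂ (λ x y → b (suc (suc κ)) * x + y) ε-det Xκ≡0))
                           (recQ κ))
                    (lemma (b (suc (suc κ))) (Q κ) (Q (suc κ)))
          where lemma : ∀ a x y → (x + y) * (a * 1ℤ + 0ℤ) - (a * y + x) ≡ (a - 1ℤ) * x
                lemma = solve-∀

    -- c is the integer part of α, and ℓ = k + 4.
    module LowerApproximations
      (c : ℤ)
      (c≤α : ∀ m → 0ℤ ℤ.≤ P (suc m) - c * Q (suc m))
      (α≤c+1 : ∀ m → 0ℤ ℤ.≤ Q (suc m) - (P (suc m) - c * Q (suc m)))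
      (c<α : Positive (λ M → P M - c * Q M))
      (P₀/Q₀≤c : ∀ p q → 1 ℕ.≤ q → 1ℤ ℤ.≤ p - c * + q → 1ℤ ℤ.≤ p * Q 0 - + q * P 0)
      (k B : ℕ)
      (small : ∀ n q → fib (suc (double n)) ℕ.≤ q → B ℕ.< q →
               b (3 ℕ.+ double n) + + 2 ℤ.≤ + (q ℕ.^ suc k))
      where

      E : ℕ → ℤ
      E q = + (q ℕ.^ suc (suc k))

      E≥1 : ∀ {q} → 1 ℕ.≤ q → 1ℤ ℤ.≤ E q
      E≥1 {q} q≥1 = +≤+ (ℕP.m^n>0 q {{ℕ.>-nonZero q≥1}} (suc (suc k)))

      -- (p - q α) in the limit, after scaling by Q M.
      below : ℤ → ℕ → ℕ → ℤ
      below p q M = p * Q M - + q * P M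

      -- E(p′, 1) - E(p, q), where E(p, q) = q^(ℓ-1) (α - p/q), after scaling by Q M.
      advantage : ℤ → ℕ → ℤ → ℕ → ℤ
      advantage p q p′ M = (1ℤ - E q * + q) * P M + (E q * p - p′) * Q M

      advantage-neg : ∀ p q p′ M → - advantage p q p′ M ≡ E q * (+ q * P M - p * Q M) - (P M - p′ * Q M)
      advantage-neg p q p′ M = lemma (E q) (+ q) p p′ (P M) (Q M)
        where lemma : ∀ e q p p′ x y → - ((1ℤ - e * q) * x + (e * p - p′) * y) ≡ e * (q * x - p * y) - (x - p′ * y)
              lemma = solve-∀

      Recurrent-below : ∀ p q → Recurrent (below p q)
      Recurrent-below p q = Recurrent-cong (λ M → lemma p (+ q) (Q M) (P M)) (Recurrent-lincomb recQ recP p (- + q))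
        where lemma : ∀ p q x y → p * x - q * y ≡ p * x + (- q) * y
              lemma = solve-∀

      -- What the proof uses of p/q being a best lower approximation: p/q ≤ α, and
      -- p/q is strictly better than c/1 and (c - 1)/1 unless it equals them.
      record Candidate (p : ℤ) (q : ℕ) : Set where
        field
          q≥1 : 1 ℕ.≤ q
          ≤α : ¬ Positive (λ m → below p q (suc m))
          beats : ∀ p′ → p′ ≡ c ⊎ p′ ≡ c - 1ℤ → p′ * + q ≢ p → Positive (advantage p q p′)

      K : ℤ
      K = Q (proj₁ c<α) + Q (suc (proj₁ c<α))

      q-max : ℕ
      q-max = B ℕ.⊔ (ℤ.∣ K ∣ ℕ.⊔ 2)

      -- K (α - c) ≥ 1.
      excess-bound : ∀ {M} → proj₁ c<α ℕ.≤ M → 0ℤ ℤ.≤ K * (P M - c * Q M) - Q M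
      excess-bound = 0≤-propagate rec (at refl (proj₁ (proj₂ c<α)) (Q≥0 j) (Q≥0 (suc j)))
                                      (at (ℤP.+-comm (Q j) (Q (suc j))) (proj₂ (proj₂ c<α)) (Q≥0 (suc j)) (Q≥0 j))
        where
        j : ℕ
        j = proj₁ c<α
        rec : Recurrent (λ M → K * (P M - c * Q M) - Q M)
        rec = Recurrent-cong (λ M → lemma K c (P M) (Q M)) (Recurrent-lincomb recP recQ K (- (K * c) - 1ℤ))
          where lemma : ∀ K c x y → K * (x - c * y) - y ≡ K * x + (- (K * c) - 1ℤ) * y
                lemma = solve-∀
        at : ∀ {f x y} → K ≡ x + y → 1ℤ ℤ.≤ f → 0ℤ ℤ.≤ x → 0ℤ ℤ.≤ y → 0ℤ ℤ.≤ K * f - x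
        at {f} {x} {y} K≡x+y 1≤f 0≤x 0≤y =
          0≤-by (trans (cong (λ z → z * f - x) K≡x+y) (lemma f x y))
                (0≤-+ (0≤-* (0≤-+ 0≤x 0≤y) (1≤⇒0≤-1 1≤f)) 0≤y)
          where lemma : ∀ f x y → (x + y) * f - x ≡ (x + y) * (f - 1ℤ) + y
                lemma = solve-∀

      module _ {p : ℤ} {q : ℕ} (cand : Candidate p q) where
        open Candidate cand

        cq≤p : 0ℤ ℤ.≤ p - c * + q
        cq≤p with 0ℤ ℤP.≤? p - c * + q
        ... | yes h = h
        ... | no h = ⊥-elim (Positive⇒¬eventually-nonpositive (Recurrent-lincomb recP recQ (1ℤ - E q * + q) (E q * p - c))
                               (beats c (inj₁ refl) (λ cq≡p → h (0≤-by (ℤP.i≡j⇒i-j≡0 (sym cq≡p)) (0≤+ 0)))) 1 nonpos)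
          where
          nonpos : ∀ M → 1 ℕ.≤ M → 0ℤ ℤ.≤ - advantage p q c M
          nonpos (suc m) _ = 0≤-by (trans (advantage-neg p q c (suc m)) (lemma (E q) (+ q) p c (P (suc m)) (Q (suc m))))
            (0≤-+ (0≤-+ (0≤-+ (0≤-* (0≤-* (1≤⇒0≤ (E≥1 q≥1)) (0≤+ q)) (c≤α m))
                              (0≤-* (0≤-* (1≤⇒0≤ (E≥1 q≥1)) (1≤⇒0≤-1 (¬0≤⇒1≤- _ h))) (Q≥0 (suc m))))
                        (0≤-* (1≤⇒0≤-1 (E≥1 q≥1)) (Q≥0 (suc m))))
                  (α≤c+1 m))
            where lemma : ∀ e q p c x y → e * (q * x - p * y) - (x - c * y) ≡
                          e * q * (x - c * y) + e * (- (p - c * q) - 1ℤ) * y + (e - 1ℤ) * y + (y - (x - c * y))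
                  lemma = solve-∀

        p≤cq+q : 0ℤ ℤ.≤ c * + q + + q - p
        p≤cq+q with 0ℤ ℤP.≤? c * + q + + q - p
        ... | yes h = h
        ... | no h = ⊥-elim (≤α (0 , above 0 , above 1))
          where
          above : ∀ m → 1ℤ ℤ.≤ below p q (suc m)
          above m = 1≤-by (lemma p (+ q) c (P (suc m)) (Q (suc m)))
            (0≤-+ (0≤-* (1≤⇒0≤-1 (¬0≤⇒1≤- _ h)) (Q≥0 (suc m)))
                  (0≤-+ (0≤-* (0≤+ q) (α≤c+1 m)) (1≤⇒0≤-1 (Q≥1 m))))
            where lemma : ∀ p q c x y → (p * y - q * x) - 1ℤ ≡
                          (- (c * q + q - p) - 1ℤ) * y + (q * (y - (x - c * y)) + (y - 1ℤ))
                  lemma = solve-∀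

        cq≡p⇒q≤K : c * + q ≡ p → + q ℤ.≤ K
        cq≡p⇒q≤K cq≡p with + q ℤP.≤? K
        ... | yes h = h
        ... | no h = ⊥-elim (Positive⇒¬eventually-nonpositive
                               (Recurrent-lincomb recP recQ (1ℤ - E q * + q) (E q * p - (c - 1ℤ)))
                               (beats (c - 1ℤ) (inj₂ refl) c-1≢) (suc j) nonpos)
          where
          j : ℕ
          j = proj₁ c<α
          c-1≢ : (c - 1ℤ) * + q ≢ p
          c-1≢ eq = 1≰0 (subst (1ℤ ℤ.≤_) q≡0 (+≤+ q≥1))
            where
            lemma : ∀ c q → c * q - (c - 1ℤ) * q ≡ q
            lemma = solve-∀
            q≡0 : + q ≡ 0ℤ
            q≡0 = trans (sym (lemma c (+ q))) (trans (cong₂ _-_ cq≡p eq) (ℤP.i≡j⇒i-j≡0 {p} refl))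
          nonpos : ∀ M → suc j ℕ.≤ M → 0ℤ ℤ.≤ - advantage p q (c - 1ℤ) M
          nonpos (suc m) (s≤s j≤m) = 0≤-by (trans (advantage-neg p q (c - 1ℤ) (suc m))
                                                  (lemma (E q) (+ q) p c K (P (suc m)) (Q (suc m)) cq≡p))
            (0≤-+ (0≤-* (0≤-+ (0≤-* (1≤⇒0≤-1 (E≥1 q≥1)) (0≤+ q)) (ℤP.i≤j⇒0≤j-i (ℤP.i<j⇒suc[i]≤j (ℤP.≰⇒> h)))) (c≤α m))
                  (excess-bound (ℕP.m≤n⇒m≤1+n j≤m)))
            where lemma : ∀ e q p c K x y → c * q ≡ p →
                          e * (q * x - p * y) - (x - (c - 1ℤ) * y) ≡
                          ((e - 1ℤ) * q + (q - (1ℤ + K))) * (x - c * y) + (K * (x - c * y) - y)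
                  lemma e q p c K x y refl = lemma′ e q c K x y
                    where lemma′ : ∀ e q c K x y → e * (q * x - c * q * y) - (x - (c - 1ℤ) * y) ≡
                                   ((e - 1ℤ) * q + (q - (1ℤ + K))) * (x - c * y) + (K * (x - c * y) - y)
                          lemma′ = solve-∀

        -- Coordinates of (q, p) in the unimodular basis (Q, P) (2n), (Q, P) (2n + 1).
        s t : ℕ → ℤ
        s n = + q * P (suc (double n)) - p * Q (suc (double n))
        t n = below p q (double n)

        q≡ : ∀ n → + q ≡ s n * Q (double n) + t n * Q (suc (double n))
        q≡ n = sym (trans (lemma p (+ q) (P (double n)) (P (suc (double n))) (Q (double n)) (Q (suc (double n))))
                          (trans (cong (+ q *_) (det-even n)) (ℤP.*-identityʳ (+ q))))
          where lemma : ∀ p q P₀ P₁ Q₀ Q₁ → (q * P₁ - p * Q₁) * Q₀ + (p * Q₀ - q * P₀) * Q₁ ≡ q * (Q₀ * P₁ - P₀ * Q₁)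
                lemma = solve-∀

        p≡ : ∀ n → p ≡ s n * P (double n) + t n * P (suc (double n))
        p≡ n = sym (trans (lemma p (+ q) (P (double n)) (P (suc (double n))) (Q (double n)) (Q (suc (double n))))
                          (trans (cong (p *_) (det-even n)) (ℤP.*-identityʳ p)))
          where lemma : ∀ p q P₀ P₁ Q₀ Q₁ → (q * P₁ - p * Q₁) * P₀ + (p * Q₀ - q * P₀) * P₁ ≡ p * (Q₀ * P₁ - P₀ * Q₁)
                lemma = solve-∀

        below-odd≡-s : ∀ n → below p q (suc (double n)) ≡ - s n
        below-odd≡-s n = lemma p (+ q) (P (suc (double n))) (Q (suc (double n)))
          where lemma : ∀ p q x y → p * y - q * x ≡ - (q * x - p * y)
                lemma = solve-∀

        -- p/q ≤ α < P (2n + 1) / Q (2n + 1).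
        s≥1 : ∀ n → 1ℤ ℤ.≤ s n
        s≥1 n with 1ℤ ℤP.≤? s n
        ... | yes h = h
        ... | no h = ⊥-elim (≤α (suc (double n) , g₂ , g₃))
          where
          g₁ : 0ℤ ℤ.≤ below p q (suc (double n))
          g₁ = 0≤-by (below-odd≡-s n) (¬1≤⇒0≤- _ h)
          Q₁t≥1 : 1ℤ ℤ.≤ Q (suc (double n)) * t n
          Q₁t≥1 = 1≤-by
            (trans (lemma p (+ q) (P (double n)) (P (suc (double n))) (Q (double n)) (Q (suc (double n))))
                   (cong (λ d → Q (double n) * below p q (suc (double n)) + (+ q * d - 1ℤ)) (det-even n)))
            (0≤-+ (0≤-* (Q≥0 (double n)) g₁)
                  (0≤-by (cong (_- 1ℤ) (ℤP.*-identityʳ (+ q))) (1≤⇒0≤-1 (+≤+ q≥1))))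
            where lemma : ∀ p q P₀ P₁ Q₀ Q₁ → Q₁ * (p * Q₀ - q * P₀) - 1ℤ ≡
                                              Q₀ * (p * Q₁ - q * P₁) + (q * (Q₀ * P₁ - P₀ * Q₁) - 1ℤ)
                  lemma = solve-∀
          g₀ : 1ℤ ℤ.≤ t n
          g₀ = 1≤-*-cancelˡ (Q≥0 (suc (double n))) Q₁t≥1
          g₂ : 1ℤ ℤ.≤ below p q (suc (suc (double n)))
          g₂ = subst (1ℤ ℤ.≤_) (sym (Recurrent-below p q (double n))) (1≤-step (b≥0 (double n)) g₀ g₁)
          g₃ : 1ℤ ℤ.≤ below p q (suc (suc (suc (double n))))
          g₃ = 1≤-propagate (Recurrent-below p q) g₁ g₂ (ℕP.n≤1+n _)

        t≥1⇒Q≤q : ∀ n → 1ℤ ℤ.≤ t n → 0ℤ ℤ.≤ + q - Q (suc (double n))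
        t≥1⇒Q≤q n t≥1 =
          0≤-by (trans (cong (_- Q (suc (double n))) (q≡ n)) (lemma (s n) (t n) (Q (double n)) (Q (suc (double n)))))
                (0≤-+ (0≤-* (1≤⇒0≤ (s≥1 n)) (Q≥0 (double n))) (0≤-* (1≤⇒0≤-1 t≥1) (Q≥0 (suc (double n)))))
          where lemma : ∀ s t x y → (s * x + t * y) - y ≡ s * x + (t - 1ℤ) * y
                lemma = solve-∀

        ¬t[q]≥1 : ¬ 1ℤ ℤ.≤ t q
        ¬t[q]≥1 h = ℕP.n≮n q (ℕP.<-≤-trans (q<double q≥1)
                   (ℕP.≤-trans (m≤fib (double q))
                     (ℤP.drop‿+≤+ (ℤP.≤-trans (Q≥fib (double q)) (ℤP.0≤i-j⇒j≤i (t≥1⇒Q≤q q h))))))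
          where q<double : ∀ {n} → 1 ℕ.≤ n → n ℕ.< double n
                q<double {suc n} _ = s≤s (s≤s (n≤double n))

        -- At such n, P (2n)/Q (2n) < p/q ≤ P (2n + 2)/Q (2n + 2), and (q, p) is
        -- s n (Q, P) (2n + 2) - r (Q, P) (2n + 1) with r ≥ 0.
        module AtCrossing (n : ℕ) (t≥1 : 1ℤ ℤ.≤ t n) (t′≱1 : ¬ 1ℤ ℤ.≤ t (suc n)) where

          a : ℤ
          a = b (suc (suc (double n)))

          r : ℤ
          r = a * s n - t n

          r≥0 : 0ℤ ℤ.≤ r
          r≥0 = 0≤-by (trans (lemma a (s n) (t n))
                             (cong -_ (sym (trans (Recurrent-below p q (double n))
                                                  (cong (λ x → a * x + t n) (below-odd≡-s n))))))
                      (¬1≤⇒0≤- (t (suc n)) t′≱1)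
            where lemma : ∀ a s t → a * s - t ≡ - (a * (- s) + t)
                  lemma = solve-∀

          U W : ℕ → ℤ
          U M = 1ℤ * cross (suc (suc (double n))) M
          W M = - 1ℤ * cross (suc (double n)) M

          det-U : 1ℤ * det (suc (suc (double n))) ≡ 1ℤ
          det-U = trans (ℤP.*-identityˡ _) (det-even (suc n))

          det-W : - 1ℤ * det (suc (double n)) ≡ 1ℤ
          det-W = cong (- 1ℤ *_) (det-odd n)

          split : ∀ M → + q * P M - p * Q M ≡ s n * U M + r * W M
          split M = begin
            + q * P M - p * Q M
              ≡⟨ cong₂ (λ x y → x * P M - y * Q M) (q≡ n) (p≡ n) ⟩
            (s n * Q₀ + t n * Q₁) * P M - (s n * P₀ + t n * P₁) * Q M
              ≡⟨ lemma (s n) (t n) a P₀ P₁ Q₀ Q₁ (P M) (Q M) ⟩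
            s n * (1ℤ * ((a * Q₁ + Q₀) * P M - (a * P₁ + P₀) * Q M)) + r * W M
              ≡⟨ cong₂ (λ x y → s n * (1ℤ * (x * P M - y * Q M)) + r * W M) (recQ (double n)) (recP (double n)) ⟨
            s n * U M + r * W M ∎
            where
            open ≡-Reasoning
            P₀ P₁ Q₀ Q₁ : ℤ
            P₀ = P (double n)
            P₁ = P (suc (double n))
            Q₀ = Q (double n)
            Q₁ = Q (suc (double n))
            lemma : ∀ s t a P₀ P₁ Q₀ Q₁ x y →
                    (s * Q₀ + t * Q₁) * x - (s * P₀ + t * P₁) * y ≡
                    s * (1ℤ * ((a * Q₁ + Q₀) * x - (a * P₁ + P₀) * y)) + (a * s - t) * (- 1ℤ * (Q₁ * x - P₁ * y))
            lemma = solve-∀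

          module _ {M : ℕ} (M≥ : 3 ℕ.+ double n ℕ.≤ M) where

            private
              M≥2n+2 : 2 ℕ.+ double n ℕ.≤ M
              M≥2n+2 = ℕP.≤-trans (ℕP.n≤1+n _) M≥

              M≥2n+1 : 1 ℕ.+ double n ℕ.≤ M
              M≥2n+1 = ℕP.≤-trans (ℕP.n≤1+n _) M≥2n+2

            U≥0 : 0ℤ ℤ.≤ U M
            U≥0 = cross-sign (suc (suc (double n))) 1ℤ det-U M≥2n+2

            W≥0 : 0ℤ ℤ.≤ W M
            W≥0 = cross-sign (suc (double n)) (- 1ℤ) det-W M≥2n+1

            -- Case p/q < P (2n + 2)/Q (2n + 2): then q α - p ≥ r |Q (2n + 1) α - P (2n + 1)|.
            far : 1ℤ ℤ.≤ r → 3 ℕ.≤ q → 0ℤ ℤ.≤ E q * (s n * U M + r * W M) - Q M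
            far r≥1 3≤q = 0≤-by (lemma (E q) (s n) (U M) r (W M) (Q M) C₁ (+ q))
              (0≤-+ (0≤-+ (0≤-* (0≤-* (1≤⇒0≤ (E≥1 q≥1)) (1≤⇒0≤ (s≥1 n))) U≥0)
                          (0≤-* (0≤-+ (0≤-* E≥3q r≥0) 3qr≥C₁) W≥0))
                    (cross-bound (suc (double n)) (- 1ℤ) det-W M≥2n+2))
              where
              C₁ : ℤ
              C₁ = Q (suc (double n)) + Q (suc (suc (double n)))
              lemma : ∀ e s U r W y C q → e * (s * U + r * W) - y ≡
                      e * s * U + ((e - q * + 3) * r + (q * + 3 * r - C)) * W + (C * W - y)
              lemma = solve-∀
              E≥3q : 0ℤ ℤ.≤ E q - + q * + 3
              E≥3q = subst (λ x → 0ℤ ℤ.≤ E q - x) (ℤP.pos-* q 3)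
                       (ℤP.i≤j⇒0≤j-i (+≤+ (ℕP.*-monoʳ-≤ q (ℕP.≤-trans 3≤q (ℕP.m≤m*n q (q ℕ.^ k)
                                                           {{ℕP.m^n≢0 q k {{ℕ.>-nonZero q≥1}}}})))))
              3qr≥C₁ : 0ℤ ℤ.≤ + q * + 3 * r - C₁
              3qr≥C₁ = 0≤-by (trans (cong₂ (λ x y → x * + 3 * r - (Q (suc (double n)) + y)) (q≡ n) (recQ (double n)))
                                    (lemma′ (s n) (t n) a (Q (double n)) (Q (suc (double n)))))
                (0≤-+ (0≤-* (Q≥0 (double n))
                            (0≤-+ (0≤-+ (0≤-* (0≤-* (0≤+ 3) (1≤⇒0≤-1 (s≥1 n))) r≥0) (0≤-* (0≤+ 3) (1≤⇒0≤-1 r≥1))) (0≤+ 2)))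
                      (0≤-* (Q≥0 (suc (double n)))
                            (0≤-+ (0≤-+ (0≤-+ (0≤-* (0≤-* (0≤+ 3) (1≤⇒0≤-1 t≥1)) (1≤⇒0≤-1 r≥1))
                                              (0≤-* (b≥0 (double n)) (1≤⇒0≤-1 (s≥1 n))))
                                        (0≤-* (0≤+ 2) (1≤⇒0≤-1 t≥1)))
                                  (0≤-* (0≤+ 2) (1≤⇒0≤-1 r≥1)))))
                where lemma′ : ∀ s t a Q₀ Q₁ → (s * Q₀ + t * Q₁) * + 3 * (a * s - t) - (Q₁ + (a * Q₁ + Q₀)) ≡
                               Q₀ * (+ 3 * (s - 1ℤ) * (a * s - t) + + 3 * ((a * s - t) - 1ℤ) + + 2) +
                               Q₁ * (+ 3 * (t - 1ℤ) * ((a * s - t) - 1ℤ) + a * (s - 1ℤ) + + 2 * (t - 1ℤ) + + 2 * ((a * s - t) - 1ℤ))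
                      lemma′ = solve-∀

            -- Case p/q = P (2n + 2)/Q (2n + 2): then q ≥ Q (2n + 2), and since b (2n + 3)
            -- is small, q^(ℓ-2) ≥ Q (2n + 2) + Q (2n + 3).
            near : 0ℤ ℤ.≤ - r → B ℕ.< q → 0ℤ ℤ.≤ E q * (s n * U M + r * W M) - Q M
            near r≤0 B<q = 0≤-by (lemma (E q) (s n) (U M) r (W M) (Q M) C₂)
              (0≤-+ (0≤-+ (0≤-+ (0≤-* (0≤-* (1≤⇒0≤ (E≥1 q≥1)) (1≤⇒0≤-1 (s≥1 n))) U≥0) (0≤-* E≥C₂ U≥0))
                          (cross-bound (suc (suc (double n))) 1ℤ det-U M≥))
                    (0≤-* (1≤⇒0≤ (E≥1 q≥1)) (0≤-* r≥0 W≥0)))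
              where
              Q₁ Q₂ C₂ : ℤ
              Q₁ = Q (suc (double n))
              Q₂ = Q (suc (suc (double n)))
              C₂ = Q₂ + Q (suc (suc (suc (double n))))
              lemma : ∀ e s U r W y C → e * (s * U + r * W) - y ≡
                      e * (s - 1ℤ) * U + (e - C) * U + (C * U - y) + e * (r * W)
              lemma = solve-∀
              q≥Q₂ : 0ℤ ℤ.≤ + q - Q₂
              q≥Q₂ = 0≤-by (trans (cong (_- Q₂) (q≡ n)) (lemma′ (s n) (t n) a (Q (double n)) Q₁ Q₂ (recQ (double n))))
                           (0≤-+ (0≤-* (1≤⇒0≤-1 (s≥1 n)) (Q≥0 (suc (suc (double n))))) (0≤-* r≤0 (Q≥0 (suc (double n)))))
                where lemma′ : ∀ s t a Q₀ Q₁ Q₂ → Q₂ ≡ a * Q₁ + Q₀ →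
                               (s * Q₀ + t * Q₁) - Q₂ ≡ (s - 1ℤ) * Q₂ + (- (a * s - t)) * Q₁
                      lemma′ s t a Q₀ Q₁ _ refl = lemma″ s t a Q₀ Q₁
                        where lemma″ : ∀ s t a Q₀ Q₁ → (s * Q₀ + t * Q₁) - (a * Q₁ + Q₀) ≡
                                       (s - 1ℤ) * (a * Q₁ + Q₀) + (- (a * s - t)) * Q₁
                              lemma″ = solve-∀
              b≤q^k : b (3 ℕ.+ double n) + + 2 ℤ.≤ + (q ℕ.^ suc k)
              b≤q^k = small n q (ℤP.drop‿+≤+ (ℤP.≤-trans (Q≥fib (suc (double n))) (ℤP.0≤i-j⇒j≤i q≥Q₂))) B<q
              E≥C₂ : 0ℤ ℤ.≤ E q - C₂
              E≥C₂ = 0≤-by (trans (cong₂ (λ x y → x - (Q₂ + y)) (ℤP.pos-* q (q ℕ.^ suc k)) (recQ (suc (double n))))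
                                  (lemma′ (+ q) (+ (q ℕ.^ suc k)) (b (3 ℕ.+ double n)) Q₁ Q₂))
                           (0≤-+ (0≤-+ (0≤-* q≥Q₂ (0≤+ _)) (0≤-* (Q≥0 (suc (suc (double n)))) (ℤP.i≤j⇒0≤j-i b≤q^k)))
                                 (Q-mono (double n)))
                where lemma′ : ∀ q X b Q₁ Q₂ → q * X - (Q₂ + (b * Q₂ + Q₁)) ≡
                               (q - Q₂) * X + Q₂ * (X - (b + + 2)) + (Q₂ - Q₁)
                      lemma′ = solve-∀

            -- q^(ℓ-2) (q α - p) ≥ 1.
            scaled-gap≥1 : B ℕ.< q → 3 ℕ.≤ q → 0ℤ ℤ.≤ E q * (+ q * P M - p * Q M) - Q M
            scaled-gap≥1 B<q 3≤q = subst (λ x → 0ℤ ℤ.≤ E q * x - Q M) (sym (split M)) (by-cases (1ℤ ℤP.≤? r))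
              where
              by-cases : Dec (1ℤ ℤ.≤ r) → 0ℤ ℤ.≤ E q * (s n * U M + r * W M) - Q M
              by-cases (yes r≥1) = far r≥1 3≤q
              by-cases (no r≱1) = near (¬1≤⇒0≤- r r≱1) B<q

        cq<p⇒q≤B⊔2 : 1ℤ ℤ.≤ p - c * + q → q ℕ.≤ B ℕ.⊔ 2
        cq<p⇒q≤B⊔2 cq<p with q ℕ.≤? B ℕ.⊔ 2
        ... | yes q≤ = q≤
        ... | no q≰ with crossing (λ n → 1ℤ ℤP.≤? t n) (P₀/Q₀≤c p q q≥1 cq<p) q ¬t[q]≥1
        ...   | n , t≥1 , t′≱1 = ⊥-elim (Positive⇒¬eventually-nonpositive
                                    (Recurrent-lincomb recP recQ (1ℤ - E q * + q) (E q * p - c))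
                                    (beats c (inj₁ refl) (λ cq≡p → 1≰0 (subst (1ℤ ℤ.≤_) (ℤP.i≡j⇒i-j≡0 (sym cq≡p)) cq<p)))
                                    (3 ℕ.+ double n) nonpos)
          where
          B<q : B ℕ.< q
          B<q = ℕP.≤-trans (s≤s (ℕP.m≤m⊔n B 2)) (ℕP.≰⇒> q≰)
          3≤q : 3 ℕ.≤ q
          3≤q = ℕP.≤-trans (s≤s (ℕP.m≤n⊔m B 2)) (ℕP.≰⇒> q≰)
          nonpos : ∀ M → 3 ℕ.+ double n ℕ.≤ M → 0ℤ ℤ.≤ - advantage p q c M
          nonpos (suc m) M≥ =
            0≤-by (trans (advantage-neg p q c (suc m))
                         (lemma (E q * (+ q * P (suc m) - p * Q (suc m))) (Q (suc m)) (P (suc m) - c * Q (suc m))))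
                  (0≤-+ (AtCrossing.scaled-gap≥1 n t≥1 t′≱1 M≥ B<q 3≤q) (α≤c+1 m))
            where lemma : ∀ x y z → x - z ≡ (x - y) + (y - z)
                  lemma = solve-∀

        q-bound : q ℕ.≤ q-max
        q-bound with 1ℤ ℤP.≤? p - c * + q
        ... | yes cq<p = ℕP.≤-trans (cq<p⇒q≤B⊔2 cq<p) (ℕP.⊔-mono-≤ (ℕP.≤-refl {B}) (ℕP.m≤n⊔m ℤ.∣ K ∣ 2))
        ... | no cq≮p = ℕP.≤-trans (ℤP.drop‿+≤+ (ℤP.≤-trans (cq≡p⇒q≤K cq≡p) (ℤP.≤-reflexive (sym (ℤP.0≤i⇒+∣i∣≡i K≥0)))))
                                   (ℕP.≤-trans (ℕP.m≤m⊔n ℤ.∣ K ∣ 2) (ℕP.m≤n⊔m B _))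
          where
          K≥0 : 0ℤ ℤ.≤ K
          K≥0 = 0≤-+ (Q≥0 _) (Q≥0 _)
          cq≡p : c * + q ≡ p
          cq≡p = sym (ℤP.i-j≡0⇒i≡j p (c * + q) (0≤∧0≤-⇒≡0 _ cq≤p (¬1≤⇒0≤- _ cq≮p)))

        bounds : 0ℤ ℤ.≤ p - c * + q × 0ℤ ℤ.≤ c * + q + + q - p × q ℕ.≤ q-max
        bounds = cq≤p , p≤cq+q , q-bound

-- Best approximations of α and of -α

module _ where
  open import Data.Integer using (_+_; _-_; _*_)

  Finitely-bounded : ∀ {R : ℤ → ℕ → Set} c N →
                     (∀ {p q} → R p q → 0ℤ ℤ.≤ p - c * + q × 0ℤ ℤ.≤ c * + q + + q - p × q ℕ.≤ N) →
                     Finitely R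
  Finitely-bounded {R} c N bounds = map pair (cartesianProduct (upTo (suc N)) (upTo (suc N))) , member
    where
    pair : ℕ × ℕ → ℤ × ℕ
    pair (i , q) = c * + q + + i , q
    member : ∀ p q → R p q → (p , q) ∈ map pair (cartesianProduct (upTo (suc N)) (upTo (suc N)))
    member p q Rpq with bounds Rpq
    ... | cq≤p , p≤cq+q , q≤N =
      subst (λ x → (x , q) ∈ map pair (cartesianProduct (upTo (suc N)) (upTo (suc N)))) p≡
            (∈-map⁺ pair (∈-cartesianProduct⁺ (∈-upTo⁺ (s≤s (ℕP.≤-trans i≤q q≤N))) (∈-upTo⁺ (s≤s q≤N))))
      where
      i : ℕ
      i = ℤ.∣ p - c * + q ∣
      +i≡ : + i ≡ p - c * + q
      +i≡ = ℤP.0≤i⇒+∣i∣≡i cq≤p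
      p≡ : c * + q + + i ≡ p
      p≡ = trans (cong (λ x → c * + q + x) +i≡) (lemma p (c * + q))
        where lemma : ∀ p x → x + (p - x) ≡ p
              lemma = solve-∀
      i≤q : i ℕ.≤ q
      i≤q = ℤP.drop‿+≤+ (ℤP.0≤i-j⇒j≤i (0≤-by (trans (cong (λ x → + q - x) +i≡) (lemma p (c * + q) (+ q))) p≤cq+q))
        where lemma : ∀ p x q → q - (p - x) ≡ x + q - p
              lemma = solve-∀

  module ContinuedFraction (A : ℕ → ℤ) (A≥1 : ∀ n → 1ℤ ℤ.≤ A (suc n)) where

    open Recurrence A (λ m → A≥1 (suc m))

    P Q : ℕ → ℤ
    P = convP A
    Q = convQ A

    recP : Recurrent P
    recP _ = refl

    recQ : Recurrent Q
    recQ _ = refl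

    Q₁≥1 : 1ℤ ℤ.≤ Q 1
    Q₁≥1 = subst (1ℤ ℤ.≤_) (sym (trans (ℤP.+-identityʳ _) (ℤP.*-identityʳ (A 1)))) (A≥1 0)

    det₀ : Q 0 * P 1 - P 0 * Q 1 ≡ 1ℤ
    det₀ = lemma (A 0) (A 1)
      where lemma : ∀ a₀ a₁ → 1ℤ * (a₁ * a₀ + 1ℤ) - a₀ * (a₁ * 1ℤ + 0ℤ) ≡ 1ℤ
            lemma = solve-∀

    Pos⇒Positive : ∀ {c d} → Pos A c d → Positive (λ M → c * P M + d * Q M)
    Pos⇒Positive (m , h₀ , h₁) = m , 0<⇒1≤ h₀ , 0<⇒1≤ h₁

    Positive⇒Pos : ∀ {c d} → Positive (λ M → c * P M + d * Q M) → Pos A c d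
    Positive⇒Pos (m , h₀ , h₁) = m , 1≤⇒0< h₀ , 1≤⇒0< h₁

    -- (α - a₀) Q M and (a₀ + 1 - α) Q M in the limit.
    excess deficit : ℕ → ℤ
    excess M = P M - A 0 * Q M
    deficit M = Q M - excess M

    private
      Recurrent-excess : Recurrent excess
      Recurrent-excess = Recurrent-cong (λ M → lemma (A 0) (P M) (Q M)) (Recurrent-lincomb recP recQ 1ℤ (- A 0))
        where lemma : ∀ a x y → x - a * y ≡ 1ℤ * x + (- a) * y
              lemma = solve-∀

      Recurrent-deficit : Recurrent deficit
      Recurrent-deficit = Recurrent-cong (λ M → lemma (A 0) (P M) (Q M)) (Recurrent-lincomb recP recQ (- 1ℤ) (1ℤ + A 0))
        where lemma : ∀ a x y → y - (x - a * y) ≡ (- 1ℤ) * x + (1ℤ + a) * y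
              lemma = solve-∀

      excess₀ : excess 0 ≡ 0ℤ
      excess₀ = lemma (A 0)
        where lemma : ∀ a → a - a * 1ℤ ≡ 0ℤ
              lemma = solve-∀

      excess₁ : excess 1 ≡ 1ℤ
      excess₁ = lemma (A 0) (A 1)
        where lemma : ∀ a₀ a₁ → (a₁ * a₀ + 1ℤ) - a₀ * (a₁ * 1ℤ + 0ℤ) ≡ 1ℤ
              lemma = solve-∀

      deficit₀ : deficit 0 ≡ 1ℤ
      deficit₀ = cong (λ x → 1ℤ - x) excess₀

      deficit₁ : deficit 1 ≡ A 1 - 1ℤ
      deficit₁ = cong₂ _-_ (trans (ℤP.+-identityʳ _) (ℤP.*-identityʳ (A 1))) excess₁

    excess≥1 : ∀ m → 1ℤ ℤ.≤ excess (suc m)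
    excess≥1 m = 1≤-propagate Recurrent-excess (0≤-by excess₀ (0≤+ 0)) (subst (1ℤ ℤ.≤_) (sym excess₁) (+≤+ (s≤s z≤n)))
                              (s≤s z≤n)

    excess≥0 : ∀ M → 0ℤ ℤ.≤ excess M
    excess≥0 zero = 0≤-by excess₀ (0≤+ 0)
    excess≥0 (suc m) = 1≤⇒0≤ (excess≥1 m)

    deficit≥0 : ∀ M → 0ℤ ℤ.≤ deficit M
    deficit≥0 M = 0≤-propagate Recurrent-deficit (0≤-by deficit₀ (0≤+ 1)) (0≤-by deficit₁ (1≤⇒0≤-1 (A≥1 0))) (z≤n {M})

    deficit≥1 : ∀ m → 1ℤ ℤ.≤ deficit (suc (suc m))
    deficit≥1 m = 1≤-propagate Recurrent-deficit deficit₁≥0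
                    (subst (1ℤ ℤ.≤_) (sym (Recurrent-deficit 0))
                           (1≤-step (1≤⇒0≤ (A≥1 1)) (subst (1ℤ ℤ.≤_) (sym deficit₀) ℤP.≤-refl) deficit₁≥0))
                    (s≤s (s≤s z≤n))
      where deficit₁≥0 : 0ℤ ℤ.≤ deficit 1
            deficit₁≥0 = 0≤-by deficit₁ (1≤⇒0≤-1 (A≥1 0))

    pw-1 : ∀ n → pw 1 n ≡ 1ℤ
    pw-1 n = cong +_ (ℕP.^-zeroˡ n)

    pw-suc : ∀ q n → pw q (suc n) ≡ + q * pw q n
    pw-suc q n = ℤP.pos-* q (q ℕ.^ n)

    module BestLowerApproximations (k : ℕ) (lim : LimsupBelow A (λ n → 2 ℕ.* n ℕ.+ 1) (suc k)) where

      private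
        index : ∀ n → 2 ℕ.* suc n ℕ.+ 1 ≡ 3 ℕ.+ double n
        index n = trans (lemma n) (cong (3 ℕ.+_) (sym (double≡2* n)))
          where lemma : ∀ n → 2 ℕ.* suc n ℕ.+ 1 ≡ 3 ℕ.+ 2 ℕ.* n
                lemma = ℕSolver.solve-∀

        quotients : Σ ℕ λ B → ∀ n q → fib (suc (double n)) ℕ.≤ q → B ℕ.< q →
                                A (2 ℕ.* suc n ℕ.+ 1) + + 2 ℤ.≤ + (q ℕ.^ suc k)
        quotients = small-quotients {A} {λ n → 2 ℕ.* n ℕ.+ 1} k
          (λ n → subst (λ i → 0ℤ ℤ.≤ A i) (sym (index n)) (1≤⇒0≤ (A≥1 (suc (suc (double n))))))
          (λ n → subst (suc (double n) ℕ.≤_) (sym (index n)) (ℕP.≤-trans (ℕP.n≤1+n _) (ℕP.n≤1+n _)))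
          (λ n → ℕP.≤-reflexive (index n))
          lim

        small : ∀ n q → fib (suc (double n)) ℕ.≤ q → proj₁ quotients ℕ.< q →
                A (3 ℕ.+ double n) + + 2 ℤ.≤ + (q ℕ.^ suc k)
        small n q fib≤q B<q = subst (λ i → A i + + 2 ℤ.≤ + (q ℕ.^ suc k)) (index n) (proj₂ quotients n q fib≤q B<q)

        P₀/Q₀≤a₀ : ∀ p q → 1 ℕ.≤ q → 1ℤ ℤ.≤ p - A 0 * + q → 1ℤ ℤ.≤ p * Q 0 - + q * P 0
        P₀/Q₀≤a₀ p q _ = subst (1ℤ ℤ.≤_) (lemma p (+ q) (A 0))
          where lemma : ∀ p q a → p - a * q ≡ p * 1ℤ - q * a
                lemma = solve-∀

      open Convergents A (λ m → A≥1 (suc m)) P Q recP recQ (0≤+ 1) Q₁≥1 det₀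
      open LowerApproximations (A 0) (λ m → excess≥0 (suc m)) (λ m → deficit≥0 (suc m))
                               (1 , excess≥1 0 , excess≥1 1) P₀/Q₀≤a₀ k (proj₁ quotients) small

      candidate : ∀ {p q} → BestLower A (4 ℕ.+ k) p q → Candidate p q
      candidate {p} {q} (q≥1 , p/q≤α , best) = record { q≥1 = q≥1 ; ≤α = ≤α ; beats = beats }
        where
        ≤α : ¬ Positive (λ m → below p q (suc m))
        ≤α (m , h₀ , h₁) = p/q≤α (Positive⇒Pos {c = - pw q (3 ℕ.+ k)} {d = - (- (pw q (2 ℕ.+ k) * p))}
                                    (Positive-cong scaled (suc m , 1≤-* (E≥1 q≥1) h₀ , 1≤-* (E≥1 q≥1) h₁)))
          where
          scaled : ∀ M → E q * below p q M ≡ (- pw q (3 ℕ.+ k)) * P M + (- (- (pw q (2 ℕ.+ k) * p))) * Q M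
          scaled M = trans (lemma (+ q) (E q) p (P M) (Q M))
                           (cong (λ z → (- z) * P M + (- (- (E q * p))) * Q M) (sym (pw-suc q (2 ℕ.+ k))))
            where lemma : ∀ q e p x y → e * (p * y - q * x) ≡ (- (q * e)) * x + (- (- (e * p))) * y
                  lemma = solve-∀
        beats : ∀ p′ → p′ ≡ A 0 ⊎ p′ ≡ A 0 - 1ℤ → p′ * + q ≢ p → Positive (advantage p q p′)
        beats p′ p′≤a₀ p′≢p = Positive-cong rescaled
          (Pos⇒Positive {c = pw 1 (3 ℕ.+ k) - pw q (3 ℕ.+ k)} {d = pw q (2 ℕ.+ k) * p - pw 1 (2 ℕ.+ k) * p′}
                        (best p′ 1 (s≤s z≤n) p′≤α (λ eq → p′≢p (trans eq (ℤP.*-identityʳ p))) q≥1))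
          where
          p′≤α : Nonneg A (+ 1) (- p′)
          p′≤α (n , h₀ , _) = 1≤∧0≤-⇒⊥ (0<⇒1≤ h₀) (0≤-by (lemma p′ (P n) (Q n)) (P-p′Q≥0 p′≤a₀))
            where
            lemma : ∀ p′ x y → - ((- 1ℤ) * x + (- (- p′)) * y) ≡ x - p′ * y
            lemma = solve-∀
            P-p′Q≥0 : p′ ≡ A 0 ⊎ p′ ≡ A 0 - 1ℤ → 0ℤ ℤ.≤ P n - p′ * Q n
            P-p′Q≥0 (inj₁ refl) = excess≥0 n
            P-p′Q≥0 (inj₂ refl) = 0≤-by (lemma′ (A 0) (P n) (Q n)) (0≤-+ (excess≥0 n) (Q≥0 n))
              where lemma′ : ∀ a x y → x - (a - 1ℤ) * y ≡ (x - a * y) + y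
                    lemma′ = solve-∀
          rescaled : ∀ M → (pw 1 (3 ℕ.+ k) - pw q (3 ℕ.+ k)) * P M + (pw q (2 ℕ.+ k) * p - pw 1 (2 ℕ.+ k) * p′) * Q M ≡
                           advantage p q p′ M
          rescaled M =
            trans (cong₂ (λ x y → (x - pw q (3 ℕ.+ k)) * P M + (E q * p - y * p′) * Q M) (pw-1 (3 ℕ.+ k)) (pw-1 (2 ℕ.+ k)))
                  (trans (cong (λ z → (1ℤ - z) * P M + (E q * p - 1ℤ * p′) * Q M) (pw-suc q (2 ℕ.+ k)))
                         (lemma (+ q) (E q) p p′ (P M) (Q M)))
            where lemma : ∀ q e p p′ x y → (1ℤ - q * e) * x + (e * p - 1ℤ * p′) * y ≡ (1ℤ - e * q) * x + (e * p - p′) * y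
                  lemma = solve-∀

      finitely-many : Finitely (BestLower A (4 ℕ.+ k))
      finitely-many = Finitely-bounded (A 0) q-max (λ best → bounds (candidate best))

    -- -α is the limit of P′/Q′, which satisfy the same recurrence with partial
    -- quotients b′ (m + 1) = A m: the index shift swaps even and odd convergents.
    P′ Q′ b′ : ℕ → ℤ
    P′ zero = - 1ℤ
    P′ (suc m) = - P m
    Q′ zero = 0ℤ
    Q′ (suc m) = Q m
    b′ zero = 0ℤ
    b′ (suc m) = A m

    module BestUpperApproximations (k : ℕ) (lim : LimsupBelow A (λ n → 2 ℕ.* n) (suc k)) where

      private
        b′≥1 : ∀ m → 1ℤ ℤ.≤ b′ (suc (suc m))
        b′≥1 = A≥1

        module R′ = Recurrence b′ b′≥1

        recP′ : R′.Recurrent P′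
        recP′ zero = lemma (A 0) (A 1)
          where lemma : ∀ a₀ a₁ → - (a₁ * a₀ + 1ℤ) ≡ a₁ * (- a₀) + (- 1ℤ)
                lemma = solve-∀
        recP′ (suc m) = lemma (A (suc (suc m))) (P (suc m)) (P m)
          where lemma : ∀ a x y → - (a * x + y) ≡ a * (- x) + (- y)
                lemma = solve-∀

        recQ′ : R′.Recurrent Q′
        recQ′ zero = refl
        recQ′ (suc m) = refl

        index : ∀ n → 2 ℕ.* suc n ≡ 2 ℕ.+ double n
        index n = trans (lemma n) (cong (2 ℕ.+_) (sym (double≡2* n)))
          where lemma : ∀ n → 2 ℕ.* suc n ≡ 2 ℕ.+ 2 ℕ.* n
                lemma = ℕSolver.solve-∀

        quotients : Σ ℕ λ B → ∀ n q → fib (suc (double n)) ℕ.≤ q → B ℕ.< q →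
                                A (2 ℕ.* suc n) + + 2 ℤ.≤ + (q ℕ.^ suc k)
        quotients = small-quotients {A} {λ n → 2 ℕ.* n} k
          (λ n → subst (λ i → 0ℤ ℤ.≤ A i) (sym (index n)) (1≤⇒0≤ (A≥1 (suc (double n)))))
          (λ n → subst (suc (double n) ℕ.≤_) (sym (index n)) (ℕP.n≤1+n _))
          (λ n → subst (ℕ._≤ 3 ℕ.+ double n) (sym (index n)) (ℕP.n≤1+n _))
          lim

        small : ∀ n q → fib (suc (double n)) ℕ.≤ q → proj₁ quotients ℕ.< q →
                b′ (3 ℕ.+ double n) + + 2 ℤ.≤ + (q ℕ.^ suc k)
        small n q fib≤q B<q = subst (λ i → A i + + 2 ℤ.≤ + (q ℕ.^ suc k)) (index n) (proj₂ quotients n q fib≤q B<q)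

        c′ : ℤ
        c′ = - A 0 - 1ℤ

        shifted-excess : ∀ m → P′ (suc m) - c′ * Q′ (suc m) ≡ deficit m
        shifted-excess m = lemma (A 0) (P m) (Q m)
          where lemma : ∀ a x y → - x - (- a - 1ℤ) * y ≡ y - (x - a * y)
                lemma = solve-∀

        c′≤α′ : ∀ m → 0ℤ ℤ.≤ P′ (suc m) - c′ * Q′ (suc m)
        c′≤α′ m = 0≤-by (shifted-excess m) (deficit≥0 m)

        α′≤c′+1 : ∀ m → 0ℤ ℤ.≤ Q′ (suc m) - (P′ (suc m) - c′ * Q′ (suc m))
        α′≤c′+1 m = 0≤-by (lemma (A 0) (P m) (Q m)) (excess≥0 m)
          where lemma : ∀ a x y → y - (- x - (- a - 1ℤ) * y) ≡ x - a * y
                lemma = solve-∀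

        c′<α′ : Positive (λ M → P′ M - c′ * Q′ M)
        c′<α′ = 3 , subst (1ℤ ℤ.≤_) (sym (shifted-excess 2)) (deficit≥1 0)
                  , subst (1ℤ ℤ.≤_) (sym (shifted-excess 3)) (deficit≥1 1)

        P′₀/Q′₀≤c′ : ∀ p q → 1 ℕ.≤ q → 1ℤ ℤ.≤ p - c′ * + q → 1ℤ ℤ.≤ p * Q′ 0 - + q * P′ 0
        P′₀/Q′₀≤c′ p q q≥1 _ = subst (1ℤ ℤ.≤_) (lemma p (+ q)) (+≤+ q≥1)
          where lemma : ∀ p q → q ≡ p * 0ℤ - q * (- 1ℤ)
                lemma = solve-∀

      open Convergents b′ b′≥1 P′ Q′ recP′ recQ′ (0≤+ 0) ℤP.≤-refl refl
      open LowerApproximations c′ c′≤α′ α′≤c′+1 c′<α′ P′₀/Q′₀≤c′ k (proj₁ quotients) small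

      candidate : ∀ {p q} → BestUpper A (4 ℕ.+ k) p q → Candidate (- p) q
      candidate {p} {q} (q≥1 , α≤p/q , best) = record { q≥1 = q≥1 ; ≤α = ≤α ; beats = beats }
        where
        ≤α : ¬ Positive (λ m → below (- p) q (suc m))
        ≤α (m , h₀ , h₁) = α≤p/q (Positive⇒Pos {c = - (- pw q (3 ℕ.+ k))} {d = - (pw q (2 ℕ.+ k) * p)}
                                    (Positive-cong scaled (m , 1≤-* (E≥1 q≥1) h₀ , 1≤-* (E≥1 q≥1) h₁)))
          where
          scaled : ∀ M → E q * below (- p) q (suc M) ≡ (- (- pw q (3 ℕ.+ k))) * P M + (- (pw q (2 ℕ.+ k) * p)) * Q M
          scaled M = trans (lemma (+ q) (E q) p (P M) (Q M))
                           (cong (λ z → (- (- z)) * P M + (- (E q * p)) * Q M) (sym (pw-suc q (2 ℕ.+ k))))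
            where lemma : ∀ q e p x y → e * ((- p) * y - q * (- x)) ≡ (- (- (q * e))) * x + (- (e * p)) * y
                  lemma = solve-∀
        beats : ∀ p′ → p′ ≡ c′ ⊎ p′ ≡ c′ - 1ℤ → p′ * + q ≢ - p → Positive (advantage (- p) q p′)
        beats p′ p′≤c′ p′≢-p
          with Pos⇒Positive {c = pw q (3 ℕ.+ k) - pw 1 (3 ℕ.+ k)} {d = pw 1 (2 ℕ.+ k) * (- p′) - pw q (2 ℕ.+ k) * p}
                            (best (- p′) 1 (s≤s z≤n) -p′≥α -p′≢p q≥1)
          where
          -p′≥α : Nonneg A (- (+ 1)) (- p′)
          -p′≥α (n , h₀ , _) = 1≤∧0≤-⇒⊥ (0<⇒1≤ h₀) (0≤-by (lemma p′ (P n) (Q n)) (-P-p′Q≥0 p′≤c′))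
            where
            lemma : ∀ p′ x y → - ((- (- 1ℤ)) * x + (- (- p′)) * y) ≡ - x - p′ * y
            lemma = solve-∀
            -P-p′Q≥0 : p′ ≡ c′ ⊎ p′ ≡ c′ - 1ℤ → 0ℤ ℤ.≤ - P n - p′ * Q n
            -P-p′Q≥0 (inj₁ refl) = c′≤α′ n
            -P-p′Q≥0 (inj₂ refl) = 0≤-by (lemma′ c′ (P n) (Q n)) (0≤-+ (c′≤α′ n) (Q≥0 (suc n)))
              where lemma′ : ∀ c x y → - x - (c - 1ℤ) * y ≡ (- x - c * y) + y
                    lemma′ = solve-∀
          -p′≢p : ¬ ((- p′) * + q ≡ p * + 1)
          -p′≢p eq = p′≢-p (trans (lemma p′ (+ q)) (cong -_ (trans eq (ℤP.*-identityʳ p))))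
            where lemma : ∀ x y → x * y ≡ - ((- x) * y)
                  lemma = solve-∀
        ... | n , h₀ , h₁ = suc n , subst (1ℤ ℤ.≤_) (rescaled n) h₀ , subst (1ℤ ℤ.≤_) (rescaled (suc n)) h₁
          where
          rescaled : ∀ M → (pw q (3 ℕ.+ k) - pw 1 (3 ℕ.+ k)) * P M + (pw 1 (2 ℕ.+ k) * (- p′) - pw q (2 ℕ.+ k) * p) * Q M ≡
                           advantage (- p) q p′ (suc M)
          rescaled M =
            trans (cong₂ (λ x y → (pw q (3 ℕ.+ k) - x) * P M + (y * (- p′) - E q * p) * Q M) (pw-1 (3 ℕ.+ k)) (pw-1 (2 ℕ.+ k)))
                  (trans (cong (λ z → (z - 1ℤ) * P M + (1ℤ * (- p′) - E q * p) * Q M) (pw-suc q (2 ℕ.+ k)))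
                         (lemma (+ q) (E q) p p′ (P M) (Q M)))
            where lemma : ∀ q e p p′ x y → (q * e - 1ℤ) * x + (1ℤ * (- p′) - e * p) * y ≡
                                            (1ℤ - e * q) * (- x) + (e * (- p) - p′) * y
                  lemma = solve-∀

      finitely-many : Finitely (BestUpper A (4 ℕ.+ k))
      finitely-many = Finitely-bounded (A 0) q-max negated-bounds
        where
        negated-bounds : ∀ {p q} → BestUpper A (4 ℕ.+ k) p q →
                         0ℤ ℤ.≤ p - A 0 * + q × 0ℤ ℤ.≤ A 0 * + q + + q - p × q ℕ.≤ q-max
        negated-bounds {p} {q} best =
          0≤-by (lemma₁ (A 0) p (+ q)) (p≤cq+q cand) , 0≤-by (lemma₂ (A 0) p (+ q)) (cq≤p cand) , q-bound cand
          where
          cand : Candidate (- p) q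
          cand = candidate best
          lemma₁ : ∀ a p q → p - a * q ≡ (- a - 1ℤ) * q + q - (- p)
          lemma₁ = solve-∀
          lemma₂ : ∀ a p q → a * q + q - p ≡ - p - (- a - 1ℤ) * q
          lemma₂ = solve-∀

open import Data.Nat using (ℕ; suc; _≤_; _*_; _+_; _∸_)
open import Data.Integer using (ℤ; +_)
open import Data.Product using (_×_)

proposition9 : (ℓ : ℕ) → 4 ≤ ℓ → (A : ℕ → ℤ) → (∀ n → + 1 ℤ.≤ A (suc n))
    → (LimsupBelow A (λ n → 2 * n + 1) (ℓ ∸ 3) → Finitely (BestLower A ℓ))
    × (LimsupBelow A (λ n → 2 * n) (ℓ ∸ 3) → Finitely (BestUpper A ℓ))
proposition9 (suc (suc (suc (suc k)))) (s≤s (s≤s (s≤s (s≤s z≤n)))) A A≥1 =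
  ContinuedFraction.BestLowerApproximations.finitely-many A A≥1 k ,
  ContinuedFraction.BestUpperApproximations.finitely-many A A≥1 k
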